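{- Let $G$ be a connected undirected graph, $c:E(G)\to\mathbb{R}_{>0}$, $\mathcal{T}\subseteq V(G)$ a terminal set, $r\in\mathcal{T}$ a root terminal, and $L:V(G)\times 2^{\mathcal{T}}\to\mathbb{R}_{\ge 0}$ a valid lower bound. Then the Dijkstra–Steiner algorithm (described in the context) run on this input terminates and returns the edge set of an optimum Steiner tree for $\mathcal{T}$ in $G$.
   Context: A Steiner tree for $X\subseteq V(G)$ is a tree $T$ in $G$ with $X\subseteq V(T)$; $\mathrm{smt}(X)$ denotes the minimum cost $c(E(T))$ of such a tree (so $\mathrm{smt}(\{x\})=0$). A function $L:V(G)\times 2^{\mathcal{T}}\to\mathbb{R}_{\ge0}$ is a valid lower bound (w.r.t. $r$) if $L(r,\{r\})=0$ and $L(v,I)\le L(w,I')+\mathrm{smt}((I\setminus I')\cup\{v,w\})$ for all $v,w\in V(G)$ and all $\{r\}\subseteq I'\subseteq I\subseteq\mathcal{T}$. Dijkstra–Steiner algorithm. Labels are pairs $(v,I)\in V(G)\times 2^{\mathcal{T}\setminus\{r\}}$, each with a value $l(v,I)\in\mathbb{R}_{\ge0}\cup\{\infty\}$ and backtracking data $b(v,I)\subseteq V(G)\times2^{\mathcal{T}\setminus\{r\}}$. Initialization: $l(v,I)=\infty$ for all $(v,I)$; then $l(s,\{s\})=0$ for all $s\in\mathcal{T}\setminus\{r\}$; $l(v,\emptyset)=0$ for all $v$; $b(v,I)=\emptyset$ for all $(v,I)$; $N=\{(s,\{s\}):s\in\mathcal{T}\setminus\{r\}\}$; $P=V(G)\times\{\emptyset\}$.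 While $(r,\mathcal{T}\setminus\{r\})\notin P$: choose $(v,I)\in N$ minimizing $l(v,I)+L(v,\mathcal{T}\setminus I)$; remove it from $N$ and add it to $P$; for every edge $e=\{v,w\}$: if $l(v,I)+c(e)<l(w,I)$ and $(w,I)\notin P$, set $l(w,I):=l(v,I)+c(e)$, $b(w,I):=\{(v,I)\}$, $N:=N\cup\{(w,I)\}$; for every nonempty $J\subseteq(\mathcal{T}\setminus\{r\})\setminus I$ with $(v,J)\in P$: if $l(v,I)+l(v,J)<l(v,I\cup J)$ and $(v,I\cup J)\notin P$, set $l(v,I\cup J):=l(v,I)+l(v,J)$, $b(v,I\cup J):=\{(v,I),(v,J)\}$, $N:=N\cup\{(v,I\cup J)\}$. Finally return $\mathrm{backtrack}(r,\mathcal{T}\setminus\{r\})$, where $\mathrm{backtrack}(v,I)$ returns $\{\{v,w\}\}\cup\mathrm{backtrack}(w,I)$ if $b(v,I)=\{(w,I)\}$, and otherwise returns $\bigcup_{(w,I')\in b(v,I)}\mathrm{backtrack}(w,I')$ (the empty set if $b(v,I)=\emptyset$). -}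

module Defs where

open import Level using (0ℓ)
open import Data.Nat using (ℕ; zero; suc)
import Data.Nat as ℕ
open import Data.Bool using (Bool; true; false; _∧_; _∨_; not; if_then_else_)
import Data.Bool as Bool
open import Data.Fin using (Fin; inject₁; fromℕ)
import Data.Fin as Fin
open import Data.Fin.Subset
  using (Subset; _∈_; _∉_; _⊆_; _∪_; _─_; ⁅_⁆; Nonempty)
  renaming (⊥ to ∅)
open import Data.Fin.Subset.Properties using (_∈?_)
open import Data.Vec using (Vec; []; _∷_)
open import Data.Vec.Properties using (≡-dec)
open import Data.Product using (Σ; ∃; _×_; _,_)
open import Data.Sum using (_⊎_)
open import Data.Empty using (⊥)
open import Data.Unit using (⊤)
open import Relation.Nullary using (¬_; does)
open import Relation.Binary.PropositionalEquality using (_≡_; _≢_)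
open import Relation.Binary.Structures using (IsStrictTotalOrder)
open import Relation.Binary.Construct.Closure.ReflexiveTransitive using (Star)
open import Algebra.Structures using (IsCommutativeRing)

-- Ordered fields (stand-in for ℝ; ℝ is an instance).  Only +, 0, < and
-- the derived ≤ are used by the statement.

record OrderedField : Set₁ where
  infixl 7 _*_
  infixl 6 _+_
  infix  4 _<_ _≤_
  field
    Carrier : Set
    _+_ _*_ : Carrier → Carrier → Carrier
    -_      : Carrier → Carrier
    0# 1#   : Carrier
    _<_     : Carrier → Carrier → Set
    isCommutativeRing  : IsCommutativeRing _≡_ _+_ _*_ -_ 0# 1#
    0≢1                : 0# ≢ 1#
    inverse            : ∀ x → x ≢ 0# → ∃ λ y → x * y ≡ 1#
    isStrictTotalOrder : IsStrictTotalOrder _≡_ _<_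
    +-mono-<           : ∀ {x y} z → x < y → x + z < y + z
    *-pos              : ∀ {x y} → 0# < x → 0# < y → 0# < x * y

  _≤_ : Carrier → Carrier → Set
  x ≤ y = x < y ⊎ x ≡ y

record Graph : Set where
  field
    nV nE    : ℕ
    src tgt  : Fin nE → Fin nV
    loopless : ∀ e → src e ≢ tgt e
    simple   : ∀ e e' → ((src e ≡ src e' × tgt e ≡ tgt e')
                         ⊎ (src e ≡ tgt e' × tgt e ≡ src e')) → e ≡ e'


module Steiner (𝔽 : OrderedField) where
  open OrderedField 𝔽

  data Ext : Set where
    fin : Carrier → Ext
    ∞   : Ext

  _⊕_ : Ext → Ext → Ext
  fin x ⊕ fin y = fin (x + y)
  _     ⊕ _     = ∞

  _<ᵉ_ : Ext → Ext → Set
  fin x <ᵉ fin y = x < y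
  fin x <ᵉ ∞     = ⊤
  ∞     <ᵉ _     = ⊥

  _≤ᵉ_ : Ext → Ext → Set
  x ≤ᵉ y = ¬ (y <ᵉ x)

  module GraphTheory (G : Graph) (c : Fin (Graph.nE G) → Carrier) where
    open Graph G public

    Joins : Fin nE → Fin nV → Fin nV → Set
    Joins e v w = (src e ≡ v × tgt e ≡ w) ⊎ (src e ≡ w × tgt e ≡ v)

    data Path (F : Subset nE) : Fin nV → Fin nV → Set where
      here : ∀ {v} → Path F v v
      step : ∀ {u w v} e → e ∈ F → Joins e u w → Path F w v → Path F u v

    allEdges : Subset nE
    allEdges = Data.Fin.Subset.⊤
      where import Data.Fin.Subset

    Connected : Set
    Connected = ∀ u v → Path allEdges u v

    record Cycle (F : Subset nE) : Set where
      field
        k        : ℕ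
        long     : 3 ℕ.≤ k
        walk     : Fin (suc k) → Fin nV
        closed   : walk Fin.zero ≡ walk (fromℕ k)
        edges    : ∀ (i : Fin k) → ∃ λ e → e ∈ F × Joins e (walk (inject₁ i)) (walk (Fin.suc i))
        distinct : ∀ (i j : Fin k) → walk (inject₁ i) ≡ walk (inject₁ j) → i ≡ j

    record IsTree (U : Subset nV) (F : Subset nE) : Set where
      field
        nonempty  : Nonempty U
        endpoints : ∀ e → e ∈ F → src e ∈ U × tgt e ∈ U
        connected : ∀ u v → u ∈ U → v ∈ U → Path F u v
        acyclic   : ¬ Cycle F

    SteinerTree : Subset nV → Subset nV → Subset nE → Set
    SteinerTree X U F = IsTree U F × X ⊆ U

    sumOver : ∀ {k} → (Fin k → Carrier) → Subset k → Carrier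
    sumOver f []           = 0#
    sumOver f (b ∷ p) = (if b then f Fin.zero else 0#) + sumOver (λ i → f (Fin.suc i)) p

    cost : Subset nE → Carrier
    cost F = sumOver c F

    IsSmt : Subset nV → Carrier → Set
    IsSmt X s = (∃ λ U → ∃ λ F → SteinerTree X U F × cost F ≡ s)
              × (∀ U F → SteinerTree X U F → s ≤ cost F)

    OptimumSteinerTreeEdges : Subset nV → Subset nE → Set
    OptimumSteinerTreeEdges X F =
      ∃ λ U → SteinerTree X U F × (∀ U' F' → SteinerTree X U' F' → cost F ≤ cost F')

    record ValidLowerBound (T : Subset nV) (r : Fin nV)
                           (L : Fin nV → Subset nV → Carrier) : Set where
      field
        nonneg : ∀ v I → I ⊆ T → 0# ≤ L v I
        root   : L r ⁅ r ⁆ ≡ 0#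
        bound  : ∀ v w I I' → ⁅ r ⁆ ⊆ I' → I' ⊆ I → I ⊆ T →
                 ∀ s → IsSmt ((I ─ I') ∪ (⁅ v ⁆ ∪ ⁅ w ⁆)) s →
                 L v I ≤ L w I' + s

  -- The Dijkstra–Steiner algorithm, as a (nondeterministic: the choice of
  -- the minimizing label) transition system on states.

  module DijkstraSteiner (G : Graph) (c : Fin (Graph.nE G) → Carrier)
                         (T : Subset (Graph.nV G)) (r : Fin (Graph.nV G))
                         (L : Fin (Graph.nV G) → Subset (Graph.nV G) → Carrier) where
    open GraphTheory G c

    T' : Subset nV
    T' = T ─ ⁅ r ⁆

    -- backtracking data b(v,I):
    --   none          = ∅
    --   viaEdge e w   = {(w,I)}   where e = {v,w}
    --   merge I₁ I₂   = {(v,I₁),(v,I₂)}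
    data BData : Set where
      none    : BData
      viaEdge : Fin nE → Fin nV → BData
      merge   : Subset nV → Subset nV → BData

    record State : Set where
      field
        l  : Fin nV → Subset nV → Ext
        b  : Fin nV → Subset nV → BData
        N  : Fin nV → Subset nV → Bool
        P  : Fin nV → Subset nV → Bool
    open State public

    _==ˢ_ : Subset nV → Subset nV → Bool
    I ==ˢ J = does (≡-dec Bool._≟_ I J)

    _==ᵛ_ : Fin nV → Fin nV → Bool
    v ==ᵛ w = does (v Fin.≟ w)

    inT' : Fin nV → Bool
    inT' v = does (v ∈? T')

    initial : State
    initial = record
      { l = λ v I → if (I ==ˢ ∅) ∨ (inT' v ∧ (I ==ˢ ⁅ v ⁆)) then fin 0# else ∞
      ; b = λ _ _ → none
      ; N = λ v I → inT' v ∧ (I ==ˢ ⁅ v ⁆)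
      ; P = λ v I → I ==ˢ ∅
      }

    Done : State → Set
    Done s = P s r T' ≡ true

    -- Effect of processing the chosen label (v,I) on label (w,K):
    -- new value, new backtracking data, and whether (w,K) is (re)inserted into N.
    -- (For a simple graph these updates touch pairwise distinct labels and
    -- read only values they do not modify, so they are performed simultaneously.)
    EdgeCond : State → Fin nV → Subset nV → Fin nV → Subset nV → Fin nE → Set
    EdgeCond s v I w K e =
      Joins e v w × K ≡ I × P s w I ≡ false × (l s v I ⊕ fin (c e)) <ᵉ l s w I

    MergeCond : State → Fin nV → Subset nV → Fin nV → Subset nV → Subset nV → Set
    MergeCond s v I w K J =
      w ≡ v × K ≡ I ∪ J × Nonempty J × J ⊆ T' ─ I × P s v J ≡ true ×
      P s v (I ∪ J) ≡ false × (l s v I ⊕ l s v J) <ᵉ l s v (I ∪ J)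

    data Update (s : State) (v : Fin nV) (I : Subset nV)
                : Fin nV → Subset nV → Ext → BData → Bool → Set where
      edgeUpd  : ∀ {w K} e → EdgeCond s v I w K e →
                 Update s v I w K (l s v I ⊕ fin (c e)) (viaEdge e v) true
      mergeUpd : ∀ {w K} J → MergeCond s v I w K J →
                 Update s v I w K (l s v I ⊕ l s v J) (merge I J) true
      noUpd    : ∀ {w K} → (∀ e → ¬ EdgeCond s v I w K e) →
                 (∀ J → ¬ MergeCond s v I w K J) →
                 Update s v I w K (l s w K) (b s w K) false

    record Step (s s' : State) : Set where
      field
        v        : Fin nV
        I        : Subset nV
        chosenN  : N s v I ≡ true
        minimal  : ∀ w K → N s w K ≡ true →
                   (l s v I ⊕ fin (L v (T ─ I))) ≤ᵉ (l s w K ⊕ fin (L w (T ─ K)))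
        added    : Fin nV → Subset nV → Bool
        update   : ∀ w K → Update s v I w K (l s' w K) (b s' w K) (added w K)
        newN     : ∀ w K → N s' w K ≡ ((N s w K ∧ not ((w ==ᵛ v) ∧ (K ==ˢ I))) ∨ added w K)
        newP     : ∀ w K → P s' w K ≡ (P s w K ∨ ((w ==ᵛ v) ∧ (K ==ˢ I)))

    LoopStep : State → State → Set
    LoopStep s s' = ¬ Done s × Step s s'

    Reachable : State → Set
    Reachable s = Star LoopStep initial s

    data Terminates (s : State) : Set where
      finished : Done s → Terminates s
      continue : ¬ Done s → (∃ λ s' → Step s s') →
                 (∀ s' → Step s s' → Terminates s') → Terminates s

    data Backtrack (s : State) : Fin nV → Subset nV → Subset nE → Set where
      btNone  : ∀ {v I} → b s v I ≡ none → Backtrack s v I ∅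
      btEdge  : ∀ {v I e w F} → b s v I ≡ viaEdge e w → Backtrack s w I F →
                Backtrack s v I (⁅ e ⁆ ∪ F)
      btMerge : ∀ {v I I₁ I₂ F₁ F₂} → b s v I ≡ merge I₁ I₂ →
                Backtrack s v I₁ F₁ → Backtrack s v I₂ F₂ →
                Backtrack s v I (F₁ ∪ F₂)

    Correct : Set
    Correct = Terminates initial
            × (∀ s → Reachable s → Done s →
                 ∃ λ F → Backtrack s r T' F × OptimumSteinerTreeEdges T F)

-- A derivation of a label (v, K) is a tree built from leaves (s, {s}), edge extensions and merges
-- of disjoint terminal sets, i.e. from exactly the operations the algorithm performs; its weight is
-- the total cost of the edges it uses. Cutting the first edge of a path from v splits any connected
-- edge set containing v and K into a derivation of no larger weight, and conversely every
-- derivation yields such an edge set. The loop keeps every processed label at the least weight of a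
-- derivation: by validity of L, a derivation of an unprocessed label passes through a label in N
-- whose key is at most the derivation's weight plus L, so the label chosen with minimum key can
-- never be improved later (the A* argument). Every iteration processes a new label, so the loop
-- terminates, and backtracking from (r, T ∖ {r}) yields a connected edge set containing T of
-- minimum cost; with positive costs such a set is acyclic, i.e. an optimum Steiner tree.

module Submission where

open import Defs
open import Algebra.Bundles using (CommutativeRing)
open import Algebra.Structures using (IsCommutativeRing)
open import Level using (0ℓ)
open import Relation.Binary.Bundles using (Poset)
import Relation.Binary.Construct.StrictToNonStrict as StrictToNonStrict
import Relation.Binary.Reasoning.PartialOrder
open import Data.Bool as Bool using (Bool; true; false; _∧_; _∨_; not; if_then_else_)
import Data.Bool.Properties as Boolₚ
open import Data.Empty using (⊥; ⊥-elim)
open import Data.Fin as Fin using (Fin; inject₁; fromℕ)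
import Data.Fin.Properties as Finₚ
open import Data.Fin.Subset
  using (Subset; _∈_; _∉_; _⊆_; _⊂_; _∪_; _∩_; _─_; _-_; ⁅_⁆; ∣_∣; Nonempty)
  renaming (⊥ to ∅)
open import Data.Fin.Subset.Properties
  using ( _∈?_; _⊆?_; _⊂?_; nonempty?; anySubset?; ⊆-antisym; Empty-unique; ∉⊥; x∈⁅x⁆; x∈⁅y⁆⇒x≡y
        ; x∈p∪q⁺; x∈p∪q⁻; x∈p∩q⁺; x∈p∩q⁻; p─q⊆p; x∈p∧x∉q⇒x∈p─q; x∈p∧x≢y⇒x∈p-y
        ; p⊆p∪q; q⊆p∪q; ∪-comm; ∪-identityˡ; ∪-identityʳ
        ; ∣p∣≤n; p⊆q⇒∣p∣≤∣q∣; p⊂q⇒∣p∣<∣q∣; x∈p⇒∣p-x∣<∣p∣ )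
open import Data.List as List using (List; []; _∷_; allFin; cartesianProduct)
open import Data.List.Membership.Propositional using () renaming (_∈_ to _∈ₗ_)
import Data.List.Membership.Propositional.Properties as Listₚ
open import Data.List.Relation.Unary.Any using (here; there)
open import Data.Nat as ℕ using (ℕ; zero; suc; s≤s; z≤n)
open import Data.Nat.GeneralisedArithmetic using (fold)
import Data.Nat.Properties as ℕₚ
open import Data.Product using (Σ; ∃; ∃₂; _×_; _,_; proj₁; proj₂)
open import Data.Sum using (_⊎_; inj₁; inj₂; [_,_]′; map₂)
open import Data.Unit using (tt)
open import Data.Vec using ([]; _∷_; tabulate)
import Data.Vec.Base as Vec
open import Data.Vec.Properties using (≡-dec; lookup∘tabulate; []=⇒lookup; lookup⇒[]=)
open import Relation.Binary.Construct.Closure.ReflexiveTransitive using (Star; ε; _◅_)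
open import Relation.Binary.Definitions using (tri<; tri≈; tri>)
open import Relation.Binary.PropositionalEquality
open import Function using (_∘_)
open import Relation.Nullary using (¬_; Dec; yes; no; does)
open import Relation.Nullary.Decidable using (_×-dec_; _⊎-dec_; _→-dec_; map′; dec-true; dec-false)

module OrderedFieldProperties (𝔽 : OrderedField) where
  open OrderedField 𝔽
  open IsCommutativeRing isCommutativeRing
    using (+-comm; +-assoc; +-identityˡ; +-identityʳ; -‿inverseʳ)
  open import Relation.Binary.Structures using (IsStrictTotalOrder)
  open IsStrictTotalOrder isStrictTotalOrder public using (_<?_)
  open IsStrictTotalOrder isStrictTotalOrder
    using (compare; irrefl; isStrictPartialOrder) renaming (trans to <-trans)

  commutativeRing : CommutativeRing 0ℓ 0ℓ
  commutativeRing = record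
    { Carrier = Carrier ; _≈_ = _≡_ ; _+_ = _+_ ; _*_ = _*_ ; -_ = -_ ; 0# = 0# ; 1# = 1#
    ; isCommutativeRing = isCommutativeRing }

  open import Algebra.Properties.CommutativeSemigroup
    (CommutativeRing.+-commutativeSemigroup commutativeRing) public
    using () renaming (interchange to +-interchange)

  <-irrefl : ∀ {x} → ¬ (x < x)
  <-irrefl = irrefl refl

  ≤-poset : Poset 0ℓ 0ℓ 0ℓ
  ≤-poset = record
    { Carrier = Carrier ; _≈_ = _≡_ ; _≤_ = _≤_
    ; isPartialOrder = StrictToNonStrict.isPartialOrder _≡_ _<_ isStrictPartialOrder }

  module ≤-Reasoning = Relation.Binary.Reasoning.PartialOrder ≤-poset

  open Poset ≤-poset public using () renaming (refl to ≤-refl; trans to ≤-trans)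

  <-≤-trans : ∀ {x y z} → x < y → y ≤ z → x < z
  <-≤-trans x<y (inj₁ y<z)  = <-trans x<y y<z
  <-≤-trans x<y (inj₂ refl) = x<y

  ≤-<-trans : ∀ {x y z} → x ≤ y → y < z → x < z
  ≤-<-trans (inj₁ x<y)  y<z = <-trans x<y y<z
  ≤-<-trans (inj₂ refl) y<z = y<z

  ≮⇒≥ : ∀ {x y} → ¬ (x < y) → y ≤ x
  ≮⇒≥ {x} {y} x≮y with compare x y
  ... | tri< x<y _ _ = ⊥-elim (x≮y x<y)
  ... | tri≈ _ x≡y _ = inj₂ (sym x≡y)
  ... | tri> _ _ y<x = inj₁ y<x

  ≤⇒≯ : ∀ {x y} → x ≤ y → ¬ (y < x)
  ≤⇒≯ x≤y y<x = <-irrefl (≤-<-trans x≤y y<x)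

  ≤-total : ∀ x y → x ≤ y ⊎ y < x
  ≤-total x y with compare x y
  ... | tri< x<y _ _ = inj₁ (inj₁ x<y)
  ... | tri≈ _ x≡y _ = inj₁ (inj₂ x≡y)
  ... | tri> _ _ y<x = inj₂ y<x

  +-monoˡ-< : ∀ {x y} z → x < y → z + x < z + y
  +-monoˡ-< {x} {y} z x<y rewrite +-comm z x | +-comm z y = +-mono-< z x<y

  +-monoʳ-≤ : ∀ {x y} z → x ≤ y → x + z ≤ y + z
  +-monoʳ-≤ z (inj₁ x<y)  = inj₁ (+-mono-< z x<y)
  +-monoʳ-≤ z (inj₂ refl) = ≤-refl

  +-monoˡ-≤ : ∀ {x y} z → x ≤ y → z + x ≤ z + y
  +-monoˡ-≤ z (inj₁ x<y)  = inj₁ (+-monoˡ-< z x<y)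
  +-monoˡ-≤ z (inj₂ refl) = ≤-refl

  +-mono-≤ : ∀ {x y z w} → x ≤ y → z ≤ w → x + z ≤ y + w
  +-mono-≤ {y = y} {z = z} x≤y z≤w = ≤-trans (+-monoʳ-≤ z x≤y) (+-monoˡ-≤ y z≤w)

  +-cancelʳ-≤ : ∀ {x y} z → x + z ≤ y + z → x ≤ y
  +-cancelʳ-≤ {x} {y} z x+z≤y+z = subst₂ _≤_ (x+z-z x) (x+z-z y) (+-monoʳ-≤ (- z) x+z≤y+z)
    where
    x+z-z : ∀ x → (x + z) + (- z) ≡ x
    x+z-z x rewrite +-assoc x z (- z) | -‿inverseʳ z = +-identityʳ x

  x≤x+y : ∀ x {y} → 0# ≤ y → x ≤ x + y
  x≤x+y x 0≤y = subst (_≤ x + _) (+-identityʳ x) (+-monoˡ-≤ x 0≤y)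

  x<x+y : ∀ x {y} → 0# < y → x < x + y
  x<x+y x 0<y = subst (_< x + _) (+-identityʳ x) (+-monoˡ-< x 0<y)

  y≤x+y : ∀ {x} y → 0# ≤ x → y ≤ x + y
  y≤x+y {x} y 0≤x = subst (y ≤_) (+-comm y x) (x≤x+y y 0≤x)

  0≤x+y : ∀ {x y} → 0# ≤ x → 0# ≤ y → 0# ≤ x + y
  0≤x+y 0≤x 0≤y = ≤-trans 0≤x (x≤x+y _ 0≤y)

≡true⇒≢false : ∀ {b} → b ≡ true → b ≢ false
≡true⇒≢false refl ()

∧≡true⁻ : ∀ {x y} → x ∧ y ≡ true → x ≡ true × y ≡ true
∧≡true⁻ {true} {true} _ = refl , refl

∨≡true⁻ : ∀ {x y} → x ∨ y ≡ true → x ≡ true ⊎ y ≡ true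
∨≡true⁻ {true}  _   = inj₁ refl
∨≡true⁻ {false} y≡t = inj₂ y≡t

∧-not-∨⁻ : ∀ {x y z} → x ∧ not y ∨ z ≡ true → (x ≡ true × y ≡ false) ⊎ z ≡ true
∧-not-∨⁻ {true} {false} _    = inj₁ (refl , refl)
∧-not-∨⁻ {true} {true}  z≡t = inj₂ z≡t
∧-not-∨⁻ {false}        z≡t = inj₂ z≡t

does-true⇒ : ∀ {A : Set} (a? : Dec A) → does a? ≡ true → A
does-true⇒ (yes a) _ = a

does-false⇒ : ∀ {A : Set} (a? : Dec A) → does a? ≡ false → ¬ A
does-false⇒ (no ¬a) _ = ¬a

x∈p─q⁻ : ∀ {n} {x : Fin n} (p q : Subset n) → x ∈ p ─ q → x ∈ p × x ∉ q
x∈p─q⁻ (true ∷ p)  (false ∷ q) Vec.here = Vec.here , λ ()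
x∈p─q⁻ {x = Fin.zero} (false ∷ p) (true ∷ q)  ()
x∈p─q⁻ {x = Fin.zero} (false ∷ p) (false ∷ q) ()
x∈p─q⁻ (_ ∷ p)     (_ ∷ q)     (Vec.there x∈p─q) with x∈p─q⁻ p q x∈p─q
... | x∈p , x∉q = Vec.there x∈p , λ { (Vec.there x∈q) → x∉q x∈q }

subsetOf : ∀ {n} {P : Fin n → Set} → (∀ x → Dec (P x)) → Subset n
subsetOf P? = tabulate (λ x → does (P? x))

∈-subsetOf⁺ : ∀ {n} {P : Fin n → Set} (P? : ∀ x → Dec (P x)) {x} → P x → x ∈ subsetOf P?
∈-subsetOf⁺ P? {x} px = lookup⇒[]= x _ (trans (lookup∘tabulate _ x) (dec-true (P? x) px))

∈-subsetOf⁻ : ∀ {n} {P : Fin n → Set} (P? : ∀ x → Dec (P x)) {x} → x ∈ subsetOf P? → P x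
∈-subsetOf⁻ P? {x} x∈ = does-true⇒ (P? x) (trans (sym (lookup∘tabulate _ x)) ([]=⇒lookup x∈))

allSubsets : ∀ n → List (Subset n)
allSubsets zero    = [] ∷ []
allSubsets (suc n) = List.map (true ∷_) (allSubsets n) List.++ List.map (false ∷_) (allSubsets n)

∈-allSubsets : ∀ {n} (p : Subset n) → p ∈ₗ allSubsets n
∈-allSubsets []                = here refl
∈-allSubsets {suc n} (true ∷ p)  = Listₚ.∈-++⁺ˡ (Listₚ.∈-map⁺ (true ∷_) (∈-allSubsets p))
∈-allSubsets {suc n} (false ∷ p) =
  Listₚ.∈-++⁺ʳ (List.map (true ∷_) (allSubsets n)) (Listₚ.∈-map⁺ (false ∷_) (∈-allSubsets p))

⊆∧⊄⇒≡ : ∀ {n} {p q : Subset n} → p ⊆ q → ¬ (p ⊂ q) → p ≡ q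
⊆∧⊄⇒≡ {p = p} {q} p⊆q p⊄q = ⊆-antisym p⊆q q⊆p
  where
  q⊆p : q ⊆ p
  q⊆p {x} x∈q with x ∈? p
  ... | yes x∈p = x∈p
  ... | no  x∉p = ⊥-elim (p⊄q (p⊆q , x , x∈q , x∉p))

-- Each non-final step of the iteration adds an element, and there are only n to add.
inflationary-fixpoint : ∀ {n} (f : Subset n → Subset n) → (∀ p → p ⊆ f p) →
                        ∀ p → f (fold p f n) ≡ fold p f n
inflationary-fixpoint {n} f f-infl p with fixed-or-large n
  where
  fixed-or-large : ∀ k → f (fold p f k) ≡ fold p f k ⊎ k ℕ.≤ ∣ fold p f k ∣
  fixed-or-large zero = inj₂ z≤n
  fixed-or-large (suc k) with fixed-or-large k
  ... | inj₁ fixed = inj₁ (cong f fixed)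
  ... | inj₂ large with fold p f k ⊂? f (fold p f k)
  ...   | yes grows = inj₂ (ℕₚ.<-≤-trans (s≤s large) (p⊂q⇒∣p∣<∣q∣ grows))
  ...   | no  stays = inj₁ (cong f (sym (⊆∧⊄⇒≡ (f-infl _) stays)))
... | inj₁ fixed = fixed
... | inj₂ large with fold p f n ⊂? f (fold p f n)
...   | yes grows =
  ⊥-elim (ℕₚ.<⇒≱ (ℕₚ.<-≤-trans (s≤s large) (p⊂q⇒∣p∣<∣q∣ grows)) (∣p∣≤n (f (fold p f n))))
...   | no  stays = sym (⊆∧⊄⇒≡ (f-infl _) stays)

⁅x⁆∪[p-x]≡p : ∀ {n} {x : Fin n} {p} → x ∈ p → ⁅ x ⁆ ∪ (p - x) ≡ p
⁅x⁆∪[p-x]≡p {x = x} {p} x∈p = ⊆-antisym ⊆p p⊆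
  where
  ⊆p : ⁅ x ⁆ ∪ (p - x) ⊆ p
  ⊆p y∈ with x∈p∪q⁻ _ _ y∈
  ... | inj₁ y∈x  rewrite x∈⁅y⁆⇒x≡y x y∈x = x∈p
  ... | inj₂ y∈p-x = p─q⊆p p _ y∈p-x
  p⊆ : p ⊆ ⁅ x ⁆ ∪ (p - x)
  p⊆ {y} y∈p with y Fin.≟ x
  ... | yes refl = p⊆p∪q _ (x∈⁅x⁆ x)
  ... | no  y≢x  = q⊆p∪q _ _ (x∈p∧x≢y⇒x∈p-y y∈p y≢x)

[p∩q]∪[p─q]≡p : ∀ {n} (p q : Subset n) → (p ∩ q) ∪ (p ─ q) ≡ p
[p∩q]∪[p─q]≡p p q = ⊆-antisym ⊆p p⊆
  where
  ⊆p : (p ∩ q) ∪ (p ─ q) ⊆ p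
  ⊆p x∈ with x∈p∪q⁻ _ _ x∈
  ... | inj₁ x∈p∩q = proj₁ (x∈p∩q⁻ p q x∈p∩q)
  ... | inj₂ x∈p─q = p─q⊆p p q x∈p─q
  p⊆ : p ⊆ (p ∩ q) ∪ (p ─ q)
  p⊆ {x} x∈p with x ∈? q
  ... | yes x∈q = p⊆p∪q _ (x∈p∩q⁺ (x∈p , x∈q))
  ... | no  x∉q = q⊆p∪q _ _ (x∈p∧x∉q⇒x∈p─q x∈p x∉q)

empty[p∩q]⇒p─q≡p : ∀ {n} (p q : Subset n) → ¬ Nonempty (p ∩ q) → p ─ q ≡ p
empty[p∩q]⇒p─q≡p p q p∩q≡∅ = begin
  p ─ q               ≡⟨ ∪-identityˡ (p ─ q) ⟨
  ∅ ∪ (p ─ q)         ≡⟨ cong (_∪ (p ─ q)) (Empty-unique p∩q≡∅) ⟨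
  (p ∩ q) ∪ (p ─ q)   ≡⟨ [p∩q]∪[p─q]≡p p q ⟩
  p                   ∎
  where open ≡-Reasoning

empty[p─q]⇒p∩q≡p : ∀ {n} (p q : Subset n) → ¬ Nonempty (p ─ q) → p ∩ q ≡ p
empty[p─q]⇒p∩q≡p p q p─q≡∅ = begin
  p ∩ q               ≡⟨ ∪-identityʳ (p ∩ q) ⟨
  (p ∩ q) ∪ ∅         ≡⟨ cong ((p ∩ q) ∪_) (Empty-unique p─q≡∅) ⟨
  (p ∩ q) ∪ (p ─ q)   ≡⟨ [p∩q]∪[p─q]≡p p q ⟩
  p                   ∎
  where open ≡-Reasoning

nonempty∧empty[p-x]⇒p≡⁅x⁆ : ∀ {n} {x : Fin n} {p} → Nonempty p → ¬ Nonempty (p - x) → p ≡ ⁅ x ⁆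
nonempty∧empty[p-x]⇒p≡⁅x⁆ {x = x} {p} (y , y∈p) p-x≡∅ = ⊆-antisym p⊆x x⊆p
  where
  p⊆x : p ⊆ ⁅ x ⁆
  p⊆x {z} z∈p with z Fin.≟ x
  ... | yes refl = x∈⁅x⁆ x
  ... | no  z≢x  = ⊥-elim (p-x≡∅ (z , x∈p∧x≢y⇒x∈p-y z∈p z≢x))
  x⊆p : ⁅ x ⁆ ⊆ p
  x⊆p z∈x = subst (_∈ p) (trans (x∈⁅y⁆⇒x≡y x (p⊆x y∈p)) (sym (x∈⁅y⁆⇒x≡y x z∈x))) y∈p

Disjoint : ∀ {n} → Subset n → Subset n → Set
Disjoint p q = ∀ {x} → x ∈ p → x ∉ q

∪-cancelˡ : ∀ {n} {p q r : Subset n} → p ∪ q ≡ p ∪ r → Disjoint q p → Disjoint r p → q ≡ r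
∪-cancelˡ {p = p} p∪q≡p∪r q∩p≡∅ r∩p≡∅ = ⊆-antisym (⊆ p∪q≡p∪r q∩p≡∅) (⊆ (sym p∪q≡p∪r) r∩p≡∅)
  where
  ⊆ : ∀ {q r} → p ∪ q ≡ p ∪ r → Disjoint q p → q ⊆ r
  ⊆ {q} {r} p∪q≡p∪r q∩p≡∅ x∈q with x∈p∪q⁻ p r (subst (_ ∈_) p∪q≡p∪r (q⊆p∪q p q x∈q))
  ... | inj₁ x∈p = ⊥-elim (q∩p≡∅ x∈q x∈p)
  ... | inj₂ x∈r = x∈r

module Least {A : Set} (_≼_ : A → A → Set) (≼-total : ∀ x y → x ≼ y ⊎ y ≼ x)
             (≼-trans : ∀ {x y z} → x ≼ y → y ≼ z → x ≼ z) where

  ≼-refl : ∀ {x} → x ≼ x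
  ≼-refl {x} with ≼-total x x
  ... | inj₁ x≼x = x≼x
  ... | inj₂ x≼x = x≼x

  least? : ∀ {P : A → Set} → (∀ x → Dec (P x)) → (xs : List A) →
           (∃ λ x → P x × ∀ y → y ∈ₗ xs → P y → x ≼ y) ⊎ (∀ y → y ∈ₗ xs → ¬ P y)
  least? P? [] = inj₂ λ _ ()
  least? P? (x ∷ xs) with least? P? xs | P? x
  ... | inj₂ none | no ¬px =
    inj₂ λ { _ (here refl) → ¬px ; y (there y∈) → none y y∈ }
  ... | inj₂ none | yes px =
    inj₁ (x , px , λ { _ (here refl) _ → ≼-refl ; y (there y∈) py → ⊥-elim (none y y∈ py) })
  ... | inj₁ (z , pz , z≼) | no ¬px =
    inj₁ (z , pz , λ { _ (here refl) px → ⊥-elim (¬px px) ; y (there y∈) → z≼ y y∈ })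
  ... | inj₁ (z , pz , z≼) | yes px with ≼-total x z
  ...   | inj₁ x≼z = inj₁ (x , px , λ { _ (here refl) _ → ≼-refl ; y (there y∈) py → ≼-trans x≼z (z≼ y y∈ py) })
  ...   | inj₂ z≼x = inj₁ (z , pz , λ { _ (here refl) _ → z≼x ; y (there y∈) → z≼ y y∈ })

module ExtendedValueProperties (𝔽 : OrderedField) where
  open OrderedField 𝔽
  open OrderedFieldProperties 𝔽
  open Steiner 𝔽

  IsFinite : Ext → Set
  IsFinite a = ∃ λ y → a ≡ fin y

  infix 4 _≤ᶠ_
  _≤ᶠ_ : Ext → Carrier → Set
  a ≤ᶠ z = ∃ λ y → a ≡ fin y × y ≤ z

  fin-injective : ∀ {x y} → fin x ≡ fin y → x ≡ y
  fin-injective refl = refl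

  ≤ᶠ⇒finite : ∀ {a z} → a ≤ᶠ z → IsFinite a
  ≤ᶠ⇒finite (y , a≡y , _) = y , a≡y

  ≤ᶠ-≤-trans : ∀ {a z z'} → a ≤ᶠ z → z ≤ z' → a ≤ᶠ z'
  ≤ᶠ-≤-trans (y , a≡y , y≤z) z≤z' = y , a≡y , ≤-trans y≤z z≤z'

  ≤ᵉ⇒≤ᶠ : ∀ {a z} → a ≤ᵉ fin z → a ≤ᶠ z
  ≤ᵉ⇒≤ᶠ {fin y} a≤z = y , refl , ≮⇒≥ a≤z
  ≤ᵉ⇒≤ᶠ {∞}     a≤z = ⊥-elim (a≤z tt)

  <ᵉ-≤ᶠ-trans : ∀ {a b z} → a <ᵉ b → b ≤ᶠ z → a ≤ᶠ z
  <ᵉ-≤ᶠ-trans {fin x} x<y (y , refl , y≤z) = x , refl , inj₁ (<-≤-trans x<y y≤z)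

  <ᵉ⇒finite : ∀ {a b} → a <ᵉ b → IsFinite a
  <ᵉ⇒finite {fin x} _ = x , refl

  ⊕≡fin⁻ : ∀ {a b z} → a ⊕ b ≡ fin z → ∃₂ λ x y → a ≡ fin x × b ≡ fin y × z ≡ x + y
  ⊕≡fin⁻ {fin x} {fin y} refl = x , y , refl , refl , refl

  _<ᵉ?_ : ∀ a b → Dec (a <ᵉ b)
  fin x <ᵉ? fin y = x <? y
  fin x <ᵉ? ∞     = yes tt
  ∞     <ᵉ? _     = no λ ()

  ≤ᵉ-total : ∀ a b → a ≤ᵉ b ⊎ b ≤ᵉ a
  ≤ᵉ-total a b with b <ᵉ? a
  ... | no  b≮a = inj₁ b≮a
  ... | yes b<a = inj₂ (asym b a b<a)
    where
    asym : ∀ a b → a <ᵉ b → ¬ (b <ᵉ a)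
    asym (fin x) (fin y) x<y y<x = ≤⇒≯ (inj₁ x<y) y<x

  ≤ᵉ-trans : ∀ {a b d} → a ≤ᵉ b → b ≤ᵉ d → a ≤ᵉ d
  ≤ᵉ-trans {fin x} {fin y} {fin z} x≤y y≤z = ≤⇒≯ (≤-trans (≮⇒≥ x≤y) (≮⇒≥ y≤z))
  ≤ᵉ-trans {_}     {_}     {∞}     _   _   = λ ()
  ≤ᵉ-trans {∞}     {fin y} {fin z} ∞≤y _   = ⊥-elim (∞≤y tt)
  ≤ᵉ-trans {_}     {∞}     {fin z} _   ∞≤z = ⊥-elim (∞≤z tt)

module GraphProperties
  (𝔽 : OrderedField) (G : Graph) (c : Fin (Graph.nE G) → OrderedField.Carrier 𝔽)
  where
  open OrderedField 𝔽
  open OrderedFieldProperties 𝔽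
  open IsCommutativeRing isCommutativeRing using (+-comm; +-identityˡ; +-identityʳ)
  open Steiner.GraphTheory 𝔽 G c

  Nonnegative : ∀ {k} → (Fin k → Carrier) → Set
  Nonnegative f = ∀ i → 0# ≤ f i

  private
    tail : ∀ {k} → (Fin (suc k) → Carrier) → Fin k → Carrier
    tail f i = f (Fin.suc i)

    term : Bool → Carrier → Carrier
    term b x = if b then x else 0#

  sumOver-∅ : ∀ {k} (f : Fin k → Carrier) → sumOver f ∅ ≡ 0#
  sumOver-∅ {zero}  f = refl
  sumOver-∅ {suc k} f rewrite sumOver-∅ (tail f) = +-identityˡ 0#

  sumOver-⁅⁆ : ∀ {k} (f : Fin k → Carrier) i → sumOver f ⁅ i ⁆ ≡ f i
  sumOver-⁅⁆ f Fin.zero    rewrite sumOver-∅ (tail f)       = +-identityʳ _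
  sumOver-⁅⁆ f (Fin.suc i) rewrite sumOver-⁅⁆ (tail f) i = +-identityˡ _

  sumOver-nonneg : ∀ {k} {f : Fin k → Carrier} → Nonnegative f → ∀ p → 0# ≤ sumOver f p
  sumOver-nonneg f≥0 []          = ≤-refl
  sumOver-nonneg f≥0 (b ∷ p) = 0≤x+y (head b) (sumOver-nonneg (λ i → f≥0 (Fin.suc i)) p)
    where
    head : ∀ b → 0# ≤ term b _
    head true  = f≥0 Fin.zero
    head false = ≤-refl

  sumOver-mono : ∀ {k} {f : Fin k → Carrier} → Nonnegative f → ∀ {p q} → p ⊆ q →
                 sumOver f p ≤ sumOver f q
  sumOver-mono f≥0 {[]}    {[]}     p⊆q = ≤-refl
  sumOver-mono {f = f} f≥0 {b ∷ p} {b' ∷ q} p⊆q =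
    +-mono-≤ (head b b' p⊆q) (sumOver-mono (λ i → f≥0 (Fin.suc i)) (λ x∈p → drop (p⊆q (Vec.there x∈p))))
    where
    drop : ∀ {x} → Fin.suc x ∈ b' ∷ q → x ∈ q
    drop (Vec.there x∈q) = x∈q
    head : ∀ b b' → (Fin.zero ∈ b ∷ p → Fin.zero ∈ b' ∷ q) →
           term b (f Fin.zero) ≤ term b' (f Fin.zero)
    head true  true  _  = ≤-refl
    head true  false ⊆′ with ⊆′ Vec.here
    ... | ()
    head false true  _  = f≥0 Fin.zero
    head false false _  = ≤-refl

  sumOver-∪ : ∀ {k} {f : Fin k → Carrier} → Nonnegative f → ∀ p q →
              sumOver f (p ∪ q) ≤ sumOver f p + sumOver f q
  sumOver-∪ f≥0 [] [] = inj₂ (sym (+-identityˡ 0#))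
  sumOver-∪ {f = f} f≥0 (b ∷ p) (b' ∷ q)
    rewrite +-interchange (term b (f Fin.zero)) (sumOver (tail f) p) (term b' (f Fin.zero)) (sumOver (tail f) q) =
    +-mono-≤ (head b b') (sumOver-∪ (λ i → f≥0 (Fin.suc i)) p q)
    where
    head : ∀ b b' → term (b ∨ b') (f Fin.zero) ≤ term b (f Fin.zero) + term b' (f Fin.zero)
    head true  true  = x≤x+y _ (f≥0 Fin.zero)
    head true  false = inj₂ (sym (+-identityʳ _))
    head false _     = inj₂ (sym (+-identityˡ _))

  sumOver-disjoint-∪ : ∀ {k} (f : Fin k → Carrier) p q → Disjoint p q →
                       sumOver f (p ∪ q) ≡ sumOver f p + sumOver f q
  sumOver-disjoint-∪ f [] [] _ = sym (+-identityˡ 0#)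
  sumOver-disjoint-∪ f (b ∷ p) (b' ∷ q) p∩q≡∅
    rewrite +-interchange (term b (f Fin.zero)) (sumOver (tail f) p) (term b' (f Fin.zero)) (sumOver (tail f) q) =
    cong₂ _+_ (head b b' p∩q≡∅)
              (sumOver-disjoint-∪ (tail f) p q (λ x∈p x∈q → p∩q≡∅ (Vec.there x∈p) (Vec.there x∈q)))
    where
    head : ∀ b b' → Disjoint (b ∷ p) (b' ∷ q) →
           term (b ∨ b') (f Fin.zero) ≡ term b (f Fin.zero) + term b' (f Fin.zero)
    head true  true  disj = ⊥-elim (disj Vec.here Vec.here)
    head true  false _    = sym (+-identityʳ _)
    head false _     _    = sym (+-identityˡ _)

  joins? : ∀ e u w → Dec (Joins e u w)
  joins? e u w = ((src e Fin.≟ u) ×-dec (tgt e Fin.≟ w)) ⊎-dec ((src e Fin.≟ w) ×-dec (tgt e Fin.≟ u))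

  joins-sym : ∀ {e u w} → Joins e u w → Joins e w u
  joins-sym (inj₁ ends) = inj₂ ends
  joins-sym (inj₂ ends) = inj₁ ends

  joins-src-tgt : ∀ e → Joins e (src e) (tgt e)
  joins-src-tgt e = inj₁ (refl , refl)

  joins-irrefl : ∀ {e u w} → Joins e u w → u ≢ w
  joins-irrefl (inj₁ (refl , refl)) u≡w = loopless _ u≡w
  joins-irrefl (inj₂ (refl , refl)) u≡w = loopless _ (sym u≡w)

  joins-injective : ∀ {e e' u w} → Joins e u w → Joins e' u w → e ≡ e'
  joins-injective (inj₁ (a , b)) (inj₁ (a' , b')) = simple _ _ (inj₁ (trans a (sym a') , trans b (sym b')))
  joins-injective (inj₁ (a , b)) (inj₂ (a' , b')) = simple _ _ (inj₂ (trans a (sym b') , trans b (sym a')))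
  joins-injective (inj₂ (a , b)) (inj₁ (a' , b')) = simple _ _ (inj₂ (trans a (sym b') , trans b (sym a')))
  joins-injective (inj₂ (a , b)) (inj₂ (a' , b')) = simple _ _ (inj₁ (trans a (sym a') , trans b (sym b')))

  joins-ends : ∀ {e a b x y} → Joins e a b → Joins e x y → (x ≡ a × y ≡ b) ⊎ (x ≡ b × y ≡ a)
  joins-ends (inj₁ (p , q)) (inj₁ (p' , q')) = inj₁ (trans (sym p') p , trans (sym q') q)
  joins-ends (inj₁ (p , q)) (inj₂ (p' , q')) = inj₂ (trans (sym q') q , trans (sym p') p)
  joins-ends (inj₂ (p , q)) (inj₁ (p' , q')) = inj₂ (trans (sym p') p , trans (sym q') q)
  joins-ends (inj₂ (p , q)) (inj₂ (p' , q')) = inj₁ (trans (sym q') q , trans (sym p') p)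

  infixr 5 _++ₚ_
  _++ₚ_ : ∀ {F u w v} → Path F u w → Path F w v → Path F u v
  here           ++ₚ q = q
  step e e∈ j p  ++ₚ q = step e e∈ j (p ++ₚ q)

  edgePath : ∀ {F e u w} → e ∈ F → Joins e u w → Path F u w
  edgePath e∈ j = step _ e∈ j here

  reversePath : ∀ {F u v} → Path F u v → Path F v u
  reversePath here            = here
  reversePath (step e e∈ j p) = reversePath p ++ₚ edgePath e∈ (joins-sym j)

  mapPath : ∀ {F F'} → F ⊆ F' → ∀ {u v} → Path F u v → Path F' u v
  mapPath F⊆F' here            = here
  mapPath F⊆F' (step e e∈ j p) = step e (F⊆F' e∈) j (mapPath F⊆F' p)

  reroutePath : ∀ {F e a b} → Joins e a b → Path (F - e) a b → ∀ {x y} → Path F x y → Path (F - e) x y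
  reroutePath j pab here = here
  reroutePath {e = e} j pab (step e' e'∈ j' p) with e' Fin.≟ e
  ... | no  e'≢e = step e' (x∈p∧x≢y⇒x∈p-y e'∈ e'≢e) j' (reroutePath j pab p)
  ... | yes refl with joins-ends j j'
  ...   | inj₁ (refl , refl) = pab ++ₚ reroutePath j pab p
  ...   | inj₂ (refl , refl) = reversePath pab ++ₚ reroutePath j pab p

  Spans : Subset nE → Fin nV → Subset nV → Set
  Spans F v K = (∀ {x} → x ∈ K → Path F v x) × (∀ {e} → e ∈ F → Path F v (src e))

  Interconnects : Subset nE → Subset nV → Set
  Interconnects F X = ∃ λ x → x ∈ X × Spans F x X

  spans-tgt : ∀ {F v K} → Spans F v K → ∀ {e} → e ∈ F → Path F v (tgt e)
  spans-tgt (_ , toSrc) e∈ = toSrc e∈ ++ₚ edgePath e∈ (joins-src-tgt _)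

  spans-⊆ : ∀ {F v K K'} → K' ⊆ K → Spans F v K → Spans F v K'
  spans-⊆ K'⊆K (toK , toSrc) = toK ∘ K'⊆K , toSrc

  spans-reroute : ∀ {F e a b v K} → Joins e a b → Path (F - e) a b → Spans F v K → Spans (F - e) v K
  spans-reroute j pab (toK , toSrc) = reroutePath j pab ∘ toK , reroutePath j pab ∘ toSrc ∘ p─q⊆p _ _

  spans-∅ : ∀ {v K} → K ⊆ ⁅ v ⁆ → Spans ∅ v K
  spans-∅ {v} K⊆v = (λ x∈K → subst (Path ∅ v) (sym (x∈⁅y⁆⇒x≡y v (K⊆v x∈K))) here) , ⊥-elim ∘ ∉⊥

  spans-edge : ∀ {F e u w K} → Joins e u w → Spans F u K → Spans (⁅ e ⁆ ∪ F) w K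
  spans-edge {F} {e} {u} {w} j (toK , toSrc) = (λ x∈K → wu ++ₚ mapPath F⊆ (toK x∈K)) , toSrc'
    where
    F⊆ : F ⊆ ⁅ e ⁆ ∪ F
    F⊆ = x∈p∪q⁺ ∘ inj₂
    wu : Path (⁅ e ⁆ ∪ F) w u
    wu = edgePath (x∈p∪q⁺ (inj₁ (x∈⁅x⁆ e))) (joins-sym j)
    toSrc' : ∀ {e'} → e' ∈ ⁅ e ⁆ ∪ F → Path (⁅ e ⁆ ∪ F) w (src e')
    toSrc' e'∈ with x∈p∪q⁻ ⁅ e ⁆ F e'∈
    ... | inj₂ e'∈F = wu ++ₚ mapPath F⊆ (toSrc e'∈F)
    ... | inj₁ e'∈e rewrite x∈⁅y⁆⇒x≡y e e'∈e = toSrcₑ j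
      where
      toSrcₑ : Joins e u w → Path (⁅ e ⁆ ∪ F) w (src e)
      toSrcₑ (inj₁ (refl , _)) = wu
      toSrcₑ (inj₂ (refl , _)) = here

  spans-∪ : ∀ {F₁ F₂ v K₁ K₂} → Spans F₁ v K₁ → Spans F₂ v K₂ → Spans (F₁ ∪ F₂) v (K₁ ∪ K₂)
  spans-∪ {F₁} {F₂} {v} {K₁} {K₂} (toK₁ , toSrc₁) (toK₂ , toSrc₂) = toK , toSrc
    where
    toK : ∀ {x} → x ∈ K₁ ∪ K₂ → Path (F₁ ∪ F₂) v x
    toK x∈ with x∈p∪q⁻ K₁ K₂ x∈
    ... | inj₁ x∈K₁ = mapPath (p⊆p∪q F₂) (toK₁ x∈K₁)
    ... | inj₂ x∈K₂ = mapPath (q⊆p∪q F₁ F₂) (toK₂ x∈K₂)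
    toSrc : ∀ {e} → e ∈ F₁ ∪ F₂ → Path (F₁ ∪ F₂) v (src e)
    toSrc e∈ with x∈p∪q⁻ F₁ F₂ e∈
    ... | inj₁ e∈F₁ = mapPath (p⊆p∪q F₂) (toSrc₁ e∈F₁)
    ... | inj₂ e∈F₂ = mapPath (q⊆p∪q F₁ F₂) (toSrc₂ e∈F₂)

  connected⇒spans : ∀ {v K} → Connected → Spans allEdges v K
  connected⇒spans {v} connected = (λ {x} _ → connected v x) , (λ {e} _ → connected v (src e))

  interconnects⇒spans : ∀ {F X} → Interconnects F X → ∀ {y} → y ∈ X → Spans F y X
  interconnects⇒spans (_ , _ , toX , toSrc) y∈X =
    (λ x∈X → reversePath (toX y∈X) ++ₚ toX x∈X) , (λ e∈ → reversePath (toX y∈X) ++ₚ toSrc e∈)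

  steinerTree⇒spans : ∀ {X U F} → SteinerTree X U F → ∀ {y} → y ∈ X → Spans F y X
  steinerTree⇒spans (tree , X⊆U) {y} y∈X =
      (λ x∈X → IsTree.connected tree y _ (X⊆U y∈X) (X⊆U x∈X))
    , (λ {e} e∈ → IsTree.connected tree y (src e) (X⊆U y∈X) (proj₁ (IsTree.endpoints tree e e∈)))

  Adjacent : Subset nE → Subset nV → Fin nV → Set
  Adjacent F R y = ∃ λ e → e ∈ F × ∃ λ x → x ∈ R × Joins e x y

  adjacent? : ∀ F R y → Dec (Adjacent F R y)
  adjacent? F R y = Finₚ.any? λ e → (e ∈? F) ×-dec Finₚ.any? λ x → (x ∈? R) ×-dec joins? e x y

  grow : Subset nE → Subset nV → Subset nV
  grow F R = R ∪ subsetOf (adjacent? F R)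

  component : Subset nE → Fin nV → Subset nV
  component F u = fold ⁅ u ⁆ (grow F) nV

  component-closed : ∀ F u {e x y} → e ∈ F → Joins e x y → x ∈ component F u → y ∈ component F u
  component-closed F u {e} {x} e∈ j x∈ =
    subst (_ ∈_) (inflationary-fixpoint (grow F) (λ R → p⊆p∪q _) ⁅ u ⁆)
          (x∈p∪q⁺ (inj₂ (∈-subsetOf⁺ (adjacent? F _) (e , e∈ , x , x∈ , j))))

  ∈-component : ∀ F u → u ∈ component F u
  ∈-component F u = go nV
    where
    go : ∀ k → u ∈ fold ⁅ u ⁆ (grow F) k
    go zero    = x∈⁅x⁆ u
    go (suc k) = p⊆p∪q _ (go k)

  component⇒path : ∀ F u {x} → x ∈ component F u → Path F u x
  component⇒path F u = go nV
    where
    go : ∀ k {x} → x ∈ fold ⁅ u ⁆ (grow F) k → Path F u x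
    go zero    x∈ rewrite x∈⁅y⁆⇒x≡y u x∈ = here
    go (suc k) {y} y∈ with x∈p∪q⁻ _ _ y∈
    ... | inj₁ y∈R = go k y∈R
    ... | inj₂ y∈new with ∈-subsetOf⁻ (adjacent? F _) y∈new
    ...   | e , e∈ , x , x∈R , j = go k x∈R ++ₚ edgePath e∈ j

  path⇒component : ∀ F u {x} → Path F u x → x ∈ component F u
  path⇒component F u = go (∈-component F u)
    where
    go : ∀ {a x} → a ∈ component F u → Path F a x → x ∈ component F u
    go a∈ here            = a∈
    go a∈ (step e e∈ j p) = go (component-closed F u e∈ j a∈) p

  edgesFrom : Subset nV → Subset nE
  edgesFrom A = subsetOf (λ e → src e ∈? A)

  ∈-edgesFrom⁺ : ∀ {A e} → src e ∈ A → e ∈ edgesFrom A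
  ∈-edgesFrom⁺ {A} = ∈-subsetOf⁺ (λ e → src e ∈? A)

  ∈-edgesFrom⁻ : ∀ {A e} → e ∈ edgesFrom A → src e ∈ A
  ∈-edgesFrom⁻ {A} = ∈-subsetOf⁻ (λ e → src e ∈? A)

  src≡ : ∀ {e a b} → Joins e a b → src e ≡ a ⊎ src e ≡ b
  src≡ (inj₁ (src≡a , _)) = inj₁ src≡a
  src≡ (inj₂ (src≡b , _)) = inj₂ src≡b

  src∈component : ∀ {F u e a b} → e ∈ F → Joins e a b → a ∈ component F u → src e ∈ component F u
  src∈component {F} {u} e∈ j a∈ with src≡ j
  ... | inj₁ refl = a∈
  ... | inj₂ refl = component-closed F u e∈ j a∈

  data Derivation (Q : Subset nV) : Fin nV → Subset nV → Set where
    leaf  : ∀ {s} → s ∈ Q → Derivation Q s ⁅ s ⁆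
    edge  : ∀ {u w K} e → Joins e u w → Derivation Q u K → Derivation Q w K
    merge : ∀ {v K₁ K₂} → Nonempty K₁ → Nonempty K₂ → K₂ ⊆ Q ─ K₁ →
            Derivation Q v K₁ → Derivation Q v K₂ → Derivation Q v (K₁ ∪ K₂)

  weight : ∀ {Q v K} → Derivation Q v K → Carrier
  weight (leaf _)              = 0#
  weight (edge e _ d)          = weight d + c e
  weight (merge _ _ _ d₁ d₂)   = weight d₁ + weight d₂

  derivation-⊆ : ∀ {Q v K} → Derivation Q v K → K ⊆ Q
  derivation-⊆ (leaf s∈Q)  x∈ rewrite x∈⁅y⁆⇒x≡y _ x∈ = s∈Q
  derivation-⊆ (edge _ _ d) = derivation-⊆ d
  derivation-⊆ {Q} (merge _ _ K₂⊆ d₁ d₂) x∈ with x∈p∪q⁻ _ _ x∈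
  ... | inj₁ x∈K₁ = derivation-⊆ d₁ x∈K₁
  ... | inj₂ x∈K₂ = proj₁ (x∈p─q⁻ Q _ (K₂⊆ x∈K₂))

  derivation-nonempty : ∀ {Q v K} → Derivation Q v K → Nonempty K
  derivation-nonempty (leaf {s} _)              = s , x∈⁅x⁆ s
  derivation-nonempty (edge _ _ d)              = derivation-nonempty d
  derivation-nonempty (merge (x , x∈) _ _ _ _) = x , p⊆p∪q _ x∈

  BoundedDerivation : Subset nV → Fin nV → Subset nV → Carrier → Set
  BoundedDerivation Q v K z = Σ (Derivation Q v K) λ d → weight d ≤ z

  module NonnegativeCosts (c≥0 : Nonnegative c) where

    cost-nonneg : ∀ F → 0# ≤ cost F
    cost-nonneg = sumOver-nonneg c≥0

    cost-mono : ∀ {F F'} → F ⊆ F' → cost F ≤ cost F'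
    cost-mono = sumOver-mono c≥0

    cost-∪ : ∀ F F' → cost (F ∪ F') ≤ cost F + cost F'
    cost-∪ = sumOver-∪ c≥0

    cost-edge : ∀ {F e z} → cost F ≤ z → cost (⁅ e ⁆ ∪ F) ≤ z + c e
    cost-edge {F} {e} {z} F≤z = ≤-trans (cost-∪ ⁅ e ⁆ F) (begin
      cost ⁅ e ⁆ + cost F ≡⟨ cong (_+ cost F) (sumOver-⁅⁆ c e) ⟩
      c e + cost F        ≤⟨ +-monoˡ-≤ (c e) F≤z ⟩
      c e + z             ≡⟨ +-comm (c e) z ⟩
      z + c e             ∎)
      where open ≤-Reasoning

    derivation⇒spans : ∀ {Q v K} (d : Derivation Q v K) → ∃ λ F → Spans F v K × cost F ≤ weight d
    derivation⇒spans (leaf {s} _)   = ∅ , spans-∅ (λ x∈ → x∈) , inj₂ (sumOver-∅ c)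
    derivation⇒spans (edge e j d) with derivation⇒spans d
    ... | F , spans , F≤d = ⁅ e ⁆ ∪ F , spans-edge j spans , cost-edge F≤d
    derivation⇒spans (merge _ _ _ d₁ d₂) with derivation⇒spans d₁ | derivation⇒spans d₂
    ... | F₁ , spans₁ , F₁≤d₁ | F₂ , spans₂ , F₂≤d₂ =
      F₁ ∪ F₂ , spans-∪ spans₁ spans₂ , ≤-trans (cost-∪ F₁ F₂) (+-mono-≤ F₁≤d₁ F₂≤d₂)

    module Cut {F e v u} (e∈F : e ∈ F) (j : Joins e v u) where

      A : Subset nV
      A = component (F - e) u

      inner outer : Subset nE
      inner = (F - e) ∩ edgesFrom A
      outer = (F - e) ─ edgesFrom A

      inner⊆ : inner ⊆ F - e
      inner⊆ e'∈ = proj₁ (x∈p∩q⁻ _ _ e'∈)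

      outer⊆ : outer ⊆ F - e
      outer⊆ = p─q⊆p _ _

      stays-inside : ∀ {a y} → a ∈ A → Path (F - e) a y → Path inner a y
      stays-inside a∈A here = here
      stays-inside a∈A (step e' e'∈ j' p) =
        step e' (x∈p∩q⁺ (e'∈ , ∈-edgesFrom⁺ (src∈component e'∈ j' a∈A))) j'
             (stays-inside (component-closed _ u e'∈ j' a∈A) p)

      spans-inner : ∀ I → Spans inner u (I ∩ A)
      spans-inner I =
          (λ x∈ → from-u (proj₂ (x∈p∩q⁻ I A x∈)))
        , (λ e'∈ → from-u (∈-edgesFrom⁻ (proj₂ (x∈p∩q⁻ _ _ e'∈))))
        where
        from-u : ∀ {x} → x ∈ A → Path inner u x
        from-u x∈A = stays-inside (∈-component _ u) (component⇒path _ u x∈A)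

      -- A path that starts outside A can only use e from v's side, where it may stop.
      stays-outside : ∀ {y} → y ∉ A → Path F y v → Path outer y v
      stays-outside y∉A here = here
      stays-outside y∉A (step e' e'∈F j' p) with e' Fin.≟ e
      ... | yes refl with joins-ends j j'
      ...   | inj₁ (refl , _) = here
      ...   | inj₂ (refl , _) = ⊥-elim (y∉A (∈-component _ u))
      stays-outside {y} y∉A (step {w = z} e' e'∈F j' p) | no e'≢e =
        step e' (x∈p∧x∉q⇒x∈p─q e'∈F₀ src∉A) j' (stays-outside z∉A p)
        where
        e'∈F₀ : e' ∈ F - e
        e'∈F₀ = x∈p∧x≢y⇒x∈p-y e'∈F e'≢e
        z∉A : z ∉ A
        z∉A z∈A = y∉A (component-closed _ u e'∈F₀ (joins-sym j') z∈A)
        src∉A : e' ∉ edgesFrom A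
        src∉A e'∈ with src≡ j' | ∈-edgesFrom⁻ e'∈
        ... | inj₁ refl | y∈A = y∉A y∈A
        ... | inj₂ refl | z∈A = z∉A z∈A

      spans-outer : ∀ {I} → Spans F v I → Spans outer v (I ─ A)
      spans-outer {I} (toI , toSrc) =
          (λ x∈ → let x∈I , x∉A = x∈p─q⁻ I A x∈ in to-v x∉A (toI x∈I))
        , (λ e'∈ → let e'∈F-e , src∉A = x∈p─q⁻ _ _ e'∈ in
                   to-v (src∉A ∘ ∈-edgesFrom⁺) (toSrc (p─q⊆p F _ e'∈F-e)))
        where
        to-v : ∀ {x} → x ∉ A → Path F v x → Path outer v x
        to-v x∉A = reversePath ∘ stays-outside x∉A ∘ reversePath

      cost-cut : (cost inner + c e) + cost outer ≤ cost F
      cost-cut = begin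
        (cost inner + c e) + cost outer
          ≡⟨ cong (λ x → (cost inner + x) + cost outer) (sumOver-⁅⁆ c e) ⟨
        (cost inner + cost ⁅ e ⁆) + cost outer
          ≡⟨ cong (_+ cost outer) (sumOver-disjoint-∪ c inner ⁅ e ⁆ e∉inner) ⟨
        cost (inner ∪ ⁅ e ⁆) + cost outer
          ≡⟨ sumOver-disjoint-∪ c (inner ∪ ⁅ e ⁆) outer inner,e∉outer ⟨
        cost ((inner ∪ ⁅ e ⁆) ∪ outer)
          ≤⟨ cost-mono ⊆F ⟩
        cost F
          ∎
        where
        open ≤-Reasoning
        e∉F-e : e ∉ F - e
        e∉F-e e∈ = proj₂ (x∈p─q⁻ F _ e∈) (x∈⁅x⁆ e)
        e∉inner : Disjoint inner ⁅ e ⁆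
        e∉inner e'∈ e'∈e rewrite x∈⁅y⁆⇒x≡y e e'∈e = e∉F-e (inner⊆ e'∈)
        inner,e∉outer : Disjoint (inner ∪ ⁅ e ⁆) outer
        inner,e∉outer e'∈ e'∈outer with x∈p∪q⁻ _ _ e'∈
        ... | inj₁ e'∈inner = proj₂ (x∈p─q⁻ _ _ e'∈outer) (proj₂ (x∈p∩q⁻ _ _ e'∈inner))
        ... | inj₂ e'∈e rewrite x∈⁅y⁆⇒x≡y e e'∈e = e∉F-e (outer⊆ e'∈outer)
        ⊆F : (inner ∪ ⁅ e ⁆) ∪ outer ⊆ F
        ⊆F e'∈ with x∈p∪q⁻ _ _ e'∈
        ... | inj₂ e'∈outer = p─q⊆p F _ (outer⊆ e'∈outer)
        ... | inj₁ e'∈ with x∈p∪q⁻ _ _ e'∈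
        ...   | inj₁ e'∈inner = p─q⊆p F _ (inner⊆ e'∈inner)
        ...   | inj₂ e'∈e rewrite x∈⁅y⁆⇒x≡y e e'∈e = e∈F

    -- Cut the first edge e = {v, u} of a path from v to another vertex of I: the part of I
    -- in u's component A hangs off u via e, the rest stays at v, and both pieces use fewer edges.
    private
      decompose : ∀ n {Q F v I} → ∣ F ∣ ℕ.< n → Spans F v I → I ⊆ Q → Nonempty I →
                  BoundedDerivation Q v I (cost F)
      decompose-cut : ∀ n {Q F e v u I} → ∣ F ∣ ℕ.≤ n → e ∈ F → Joins e v u → Spans F v I → I ⊆ Q →
                      Nonempty I → BoundedDerivation Q v I (cost F)

      decompose n {Q} {F} {v} {I} |F|<n spans I⊆Q I≢∅ with nonempty? (I - v)
      ... | no I-v≡∅ rewrite nonempty∧empty[p-x]⇒p≡⁅x⁆ I≢∅ I-v≡∅ = leaf (I⊆Q (x∈⁅x⁆ v)) , cost-nonneg F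
      ... | yes (x , x∈I-v) with proj₁ spans (p─q⊆p I _ x∈I-v) | |F|<n
      ...   | here            | _         = ⊥-elim (proj₂ (x∈p─q⁻ I _ x∈I-v) (x∈⁅x⁆ x))
      ...   | step e e∈F j _ | s≤s |F|≤n = decompose-cut _ |F|≤n e∈F j spans I⊆Q I≢∅

      decompose-cut n {Q} {F} {e} {v} {u} {I} |F|≤n e∈F j spans I⊆Q I≢∅ =
        pieces (nonempty? (I ∩ A)) (nonempty? (I ─ A))
        where
        open Cut e∈F j

        smaller : ∀ {F'} → F' ⊆ F - e → ∣ F' ∣ ℕ.< n
        smaller F'⊆ = ℕₚ.<-≤-trans (ℕₚ.≤-<-trans (p⊆q⇒∣p∣≤∣q∣ F'⊆) (x∈p⇒∣p-x∣<∣p∣ e∈F)) |F|≤n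

        inner-derivation : Nonempty (I ∩ A) → BoundedDerivation Q u (I ∩ A) (cost inner)
        inner-derivation = decompose n (smaller inner⊆) (spans-inner I) (I⊆Q ∘ proj₁ ∘ x∈p∩q⁻ I A)

        outer-derivation : Nonempty (I ─ A) → BoundedDerivation Q v (I ─ A) (cost outer)
        outer-derivation = decompose n (smaller outer⊆) (spans-outer spans) (I⊆Q ∘ p─q⊆p I A)

        inner+e≤F : cost inner + c e ≤ cost F
        inner+e≤F = ≤-trans (x≤x+y _ (cost-nonneg outer)) cost-cut

        outer≤F : cost outer ≤ cost F
        outer≤F = ≤-trans (y≤x+y _ (0≤x+y (cost-nonneg inner) (c≥0 e))) cost-cut

        I─A⊆Q─I∩A : I ─ A ⊆ Q ─ (I ∩ A)
        I─A⊆Q─I∩A x∈ = let x∈I , x∉A = x∈p─q⁻ I A x∈ in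
          x∈p∧x∉q⇒x∈p─q (I⊆Q x∈I) (x∉A ∘ proj₂ ∘ x∈p∩q⁻ I A)

        onto-I : ∀ {K} → K ≡ I → BoundedDerivation Q v K (cost F) → BoundedDerivation Q v I (cost F)
        onto-I refl d = d

        pieces : Dec (Nonempty (I ∩ A)) → Dec (Nonempty (I ─ A)) → BoundedDerivation Q v I (cost F)
        pieces (no I∩A≡∅) _ =
          let I─A≡I = empty[p∩q]⇒p─q≡p I A I∩A≡∅
              d , d≤ = outer-derivation (subst Nonempty (sym I─A≡I) I≢∅)
          in onto-I I─A≡I (d , ≤-trans d≤ outer≤F)
        pieces (yes I∩A≢∅) (no I─A≡∅) =
          let d , d≤ = inner-derivation I∩A≢∅
          in onto-I (empty[p─q]⇒p∩q≡p I A I─A≡∅) (edge e (joins-sym j) d , ≤-trans (+-monoʳ-≤ (c e) d≤) inner+e≤F)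
        pieces (yes I∩A≢∅) (yes I─A≢∅) =
          let d₁ , d₁≤ = inner-derivation I∩A≢∅
              d₂ , d₂≤ = outer-derivation I─A≢∅
          in onto-I ([p∩q]∪[p─q]≡p I A)
                    ( merge I∩A≢∅ I─A≢∅ I─A⊆Q─I∩A (edge e (joins-sym j) d₁) d₂
                    , ≤-trans (+-mono-≤ (+-monoʳ-≤ (c e) d₁≤) d₂≤) cost-cut )

    spans⇒derivation : ∀ {Q F v I} → Spans F v I → I ⊆ Q → Nonempty I →
                       BoundedDerivation Q v I (cost F)
    spans⇒derivation = decompose _ (ℕₚ.n<1+n _)

  spans? : ∀ F v K → Dec (Spans F v K)
  spans? F v K = map′ from to
    ((K ⊆? component F v) ×-dec Finₚ.all? (λ e → (e ∈? F) →-dec (src e ∈? component F v)))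
    where
    from : K ⊆ component F v × (∀ e → e ∈ F → src e ∈ component F v) → Spans F v K
    from (K⊆ , srcs⊆) = component⇒path F v ∘ K⊆ , λ {e} e∈ → component⇒path F v (srcs⊆ e e∈)
    to : Spans F v K → K ⊆ component F v × (∀ e → e ∈ F → src e ∈ component F v)
    to (toK , toSrc) = path⇒component F v ∘ toK , λ e e∈ → path⇒component F v (toSrc e∈)

  walkPath : ∀ {F k} (w : Fin (suc k) → Fin nV) →
             (∀ i → ∃ λ e → e ∈ F × Joins e (w (inject₁ i)) (w (Fin.suc i))) →
             Path F (w Fin.zero) (w (fromℕ k))
  walkPath {k = zero}  w edges = here
  walkPath {k = suc k} w edges =
    let e , e∈ , j = edges Fin.zero in step e e∈ j (walkPath (w ∘ Fin.suc) (edges ∘ Fin.suc))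

  -- The rest of the cycle avoids its first edge e₀ = {w₀, w₁}: since the cycle has at least
  -- three distinct vertices, no later edge has the same ends.
  cycle⇒redundantEdge : ∀ {F} → Cycle F → ∃₂ λ e a → ∃ λ b → e ∈ F × Joins e a b × Path (F - e) a b
  cycle⇒redundantEdge {F} record { k = suc (suc (suc k)) ; long = s≤s (s≤s (s≤s _))
                                 ; walk = w ; closed = closed ; edges = edges ; distinct = distinct } =
    e₀ , w Fin.zero , w (Fin.suc Fin.zero) , e₀∈ , j₀ ,
    reversePath (subst (Path (F - e₀) (w (Fin.suc Fin.zero))) (sym closed)
                       (walkPath (w ∘ Fin.suc) later-edges))
    where
    e₀ = proj₁ (edges Fin.zero)
    e₀∈ = proj₁ (proj₂ (edges Fin.zero))
    j₀ = proj₂ (proj₂ (edges Fin.zero))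
    later≢e₀ : ∀ i → proj₁ (edges (Fin.suc i)) ≢ e₀
    later≢e₀ i eᵢ≡e₀
      with joins-ends j₀ (subst (λ e → Joins e _ _) eᵢ≡e₀ (proj₂ (proj₂ (edges (Fin.suc i)))))
    ... | inj₁ (wᵢ≡w₀ , _) with distinct (Fin.suc i) Fin.zero wᵢ≡w₀
    ...   | ()
    later≢e₀ i eᵢ≡e₀ | inj₂ (wᵢ≡w₁ , wᵢ₊₁≡w₀) with distinct (Fin.suc i) (Fin.suc Fin.zero) wᵢ≡w₁
    ...   | refl with distinct (Fin.suc (Fin.suc Fin.zero)) Fin.zero wᵢ₊₁≡w₀
    ...     | ()
    later-edges : ∀ i → ∃ λ e → e ∈ F - e₀ × Joins e (w (Fin.suc (inject₁ i))) (w (Fin.suc (Fin.suc i)))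
    later-edges i = let e , e∈ , j = edges (Fin.suc i) in e , x∈p∧x≢y⇒x∈p-y e∈ (later≢e₀ i) , j

  Incident : Subset nE → Fin nV → Set
  Incident F x = ∃ λ e → e ∈ F × (src e ≡ x ⊎ tgt e ≡ x)

  incident? : ∀ F x → Dec (Incident F x)
  incident? F x = Finₚ.any? λ e → (e ∈? F) ×-dec ((src e Fin.≟ x) ⊎-dec (tgt e Fin.≟ x))

  ends : Subset nE → Subset nV
  ends F = subsetOf (incident? F)

  src∈ends : ∀ {F e} → e ∈ F → src e ∈ ends F
  src∈ends {F} e∈ = ∈-subsetOf⁺ (incident? F) (_ , e∈ , inj₁ refl)

  tgt∈ends : ∀ {F e} → e ∈ F → tgt e ∈ ends F
  tgt∈ends {F} e∈ = ∈-subsetOf⁺ (incident? F) (_ , e∈ , inj₂ refl)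

  MinimumInterconnection : Subset nV → Subset nE → Set
  MinimumInterconnection X F = Interconnects F X × (∀ F' → Interconnects F' X → cost F ≤ cost F')

  module PositiveCosts (c>0 : ∀ e → 0# < c e) where
    open NonnegativeCosts (λ e → inj₁ (c>0 e))

    cost-[F-e] : ∀ {F e} → e ∈ F → cost (F - e) < cost F
    cost-[F-e] {F} {e} e∈F = subst (cost (F - e) <_) F-e+e≡F (x<x+y _ (c>0 e))
      where
      F-e+e≡F : cost (F - e) + c e ≡ cost F
      F-e+e≡F = begin
        cost (F - e) + c e         ≡⟨ cong (cost (F - e) +_) (sumOver-⁅⁆ c e) ⟨
        cost (F - e) + cost ⁅ e ⁆  ≡⟨ sumOver-disjoint-∪ c (F - e) ⁅ e ⁆ (proj₂ ∘ x∈p─q⁻ F _) ⟨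
        cost ((F - e) ∪ ⁅ e ⁆)     ≡⟨ cong cost (trans (∪-comm (F - e) ⁅ e ⁆) (⁅x⁆∪[p-x]≡p e∈F)) ⟩
        cost F                     ∎
        where open ≡-Reasoning

    minimum⇒steinerTree : ∀ {X F} → MinimumInterconnection X F → SteinerTree X (X ∪ ends F) F
    minimum⇒steinerTree {X} {F} ((x₀ , x₀∈X , toX , toSrc) , minimal) =
        record { nonempty  = x₀ , p⊆p∪q _ x₀∈X
               ; endpoints = λ e e∈ → q⊆p∪q X _ (src∈ends e∈) , q⊆p∪q X _ (tgt∈ends e∈)
               ; connected = λ u v u∈ v∈ → reversePath (fromRoot u∈) ++ₚ fromRoot v∈
               ; acyclic   = acyclic }
      , p⊆p∪q _
      where
      fromRoot : ∀ {u} → u ∈ X ∪ ends F → Path F x₀ u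
      fromRoot u∈ with x∈p∪q⁻ X _ u∈
      ... | inj₁ u∈X = toX u∈X
      ... | inj₂ u∈ends with ∈-subsetOf⁻ (incident? F) u∈ends
      ...   | e , e∈ , inj₁ refl = toSrc e∈
      ...   | e , e∈ , inj₂ refl = spans-tgt (toX , toSrc) e∈
      -- Removing an edge of a cycle keeps X interconnected and makes it strictly cheaper.
      acyclic : ¬ Cycle F
      acyclic cycle with cycle⇒redundantEdge cycle
      ... | e , a , b , e∈ , j , path =
        ≤⇒≯ (minimal (F - e) (x₀ , x₀∈X , spans-reroute j path (toX , toSrc))) (cost-[F-e] e∈)

    minimum⇒optimum : ∀ {X F} → MinimumInterconnection X F → OptimumSteinerTreeEdges X F
    minimum⇒optimum {X} {F} minimum@((x₀ , x₀∈X , _) , minimal) =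
      X ∪ ends F , minimum⇒steinerTree minimum ,
      λ U' F' tree → minimal F' (x₀ , x₀∈X , steinerTree⇒spans tree x₀∈X)

    minimum⇒smt : ∀ {X F} → MinimumInterconnection X F → IsSmt X (cost F)
    minimum⇒smt minimum =
      let U , tree , optimal = minimum⇒optimum minimum in (U , _ , tree , refl) , optimal

    minimumInterconnection : Connected → ∀ {X y} → y ∈ X → ∃ λ F → MinimumInterconnection X F
    minimumInterconnection connected {X} {y} y∈X with least? (λ F → spans? F y X) (allSubsets nE)
      where open Least (λ F F' → cost F ≤ cost F') (λ F F' → map₂ inj₁ (≤-total (cost F) (cost F'))) ≤-trans
    ... | inj₂ none = ⊥-elim (none allEdges (∈-allSubsets allEdges) (connected⇒spans connected))
    ... | inj₁ (F , spans , least) =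
      F , (y , y∈X , spans) ,
      λ F' interconnects → least F' (∈-allSubsets F') (interconnects⇒spans interconnects y∈X)

module Correctness
  (𝔽 : OrderedField) (G : Graph) (c : Fin (Graph.nE G) → OrderedField.Carrier 𝔽)
  (c>0 : ∀ e → OrderedField._<_ 𝔽 (OrderedField.0# 𝔽) (c e))
  (connected : Steiner.GraphTheory.Connected 𝔽 G c)
  (T : Subset (Graph.nV G)) (r : Fin (Graph.nV G)) (r∈T : r ∈ T)
  (L : Fin (Graph.nV G) → Subset (Graph.nV G) → OrderedField.Carrier 𝔽)
  (valid : Steiner.GraphTheory.ValidLowerBound 𝔽 G c T r L)
  where

  open OrderedField 𝔽
  open OrderedFieldProperties 𝔽
  open IsCommutativeRing isCommutativeRing using (+-comm; +-assoc; +-identityˡ)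
  open ExtendedValueProperties 𝔽
  open Steiner 𝔽
  open GraphTheory G c
  open GraphProperties 𝔽 G c
  open NonnegativeCosts (λ e → inj₁ (c>0 e))
  open PositiveCosts c>0
  open DijkstraSteiner G c T r L

  T'⊆T : T' ⊆ T
  T'⊆T = p─q⊆p T ⁅ r ⁆

  r∉T' : r ∉ T'
  r∉T' r∈ = proj₂ (x∈p─q⁻ T ⁅ r ⁆ r∈) (x∈⁅x⁆ r)

  r∈T─K : ∀ {K} → K ⊆ T' → ⁅ r ⁆ ⊆ T ─ K
  r∈T─K K⊆T' x∈r rewrite x∈⁅y⁆⇒x≡y r x∈r = x∈p∧x∉q⇒x∈p─q r∈T (r∉T' ∘ K⊆T')

  T─-antitone : ∀ {K K'} → K ⊆ K' → T ─ K' ⊆ T ─ K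
  T─-antitone K⊆K' x∈ = let x∈T , x∉K' = x∈p─q⁻ T _ x∈ in x∈p∧x∉q⇒x∈p─q x∈T (x∉K' ∘ K⊆K')

  -- Validity of L is stated for Steiner trees; a minimum Steiner tree is no costlier than F.
  lowerBound : ∀ {v w I I' F} → ⁅ r ⁆ ⊆ I' → I' ⊆ I → I ⊆ T → Spans F v (I ─ I') → Path F v w →
               L v I ≤ L w I' + cost F
  lowerBound {v} {w} {I} {I'} {F} r∈I' I'⊆I I⊆T (toI─I' , toSrc) v⇝w =
    ≤-trans (ValidLowerBound.bound valid v w I I' r∈I' I'⊆I I⊆T _ (minimum⇒smt minimum))
            (+-monoˡ-≤ (L w I') (proj₂ minimum F (v , v∈X , toX , toSrc)))
    where
    X = (I ─ I') ∪ (⁅ v ⁆ ∪ ⁅ w ⁆)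
    v∈X : v ∈ X
    v∈X = q⊆p∪q _ _ (p⊆p∪q _ (x∈⁅x⁆ v))
    minimum : MinimumInterconnection X _
    minimum = proj₂ (minimumInterconnection connected v∈X)
    toX : ∀ {x} → x ∈ X → Path F v x
    toX x∈ with x∈p∪q⁻ _ _ x∈
    ... | inj₁ x∈I─I' = toI─I' x∈I─I'
    ... | inj₂ x∈v,w with x∈p∪q⁻ _ _ x∈v,w
    ...   | inj₁ x∈v rewrite x∈⁅y⁆⇒x≡y v x∈v = here
    ...   | inj₂ x∈w rewrite x∈⁅y⁆⇒x≡y w x∈w = v⇝w

  lowerBound-edge : ∀ {e u w K} → K ⊆ T' → Joins e u w → L u (T ─ K) ≤ L w (T ─ K) + c e
  lowerBound-edge {e} {u} {w} {K} K⊆T' j =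
    ≤-trans (lowerBound (r∈T─K K⊆T') (λ x∈ → x∈) (p─q⊆p T K) (spans-⊆ nothing u→w) (proj₁ u→w (x∈⁅x⁆ w)))
            (+-monoˡ-≤ _ cost-e)
    where
    u→w : Spans (⁅ e ⁆ ∪ ∅) u ⁅ w ⁆
    u→w = spans-edge (joins-sym j) (spans-∅ (λ x∈ → x∈))
    nothing : (T ─ K) ─ (T ─ K) ⊆ ⁅ w ⁆
    nothing x∈ = let x∈T─K , x∉T─K = x∈p─q⁻ (T ─ K) _ x∈ in ⊥-elim (x∉T─K x∈T─K)
    cost-e : cost (⁅ e ⁆ ∪ ∅) ≤ c e
    cost-e = subst (cost (⁅ e ⁆ ∪ ∅) ≤_) (+-identityˡ (c e)) (cost-edge (inj₂ (sumOver-∅ c)))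

  lowerBound-merge : ∀ {v K K₁ K₂ F} → K ⊆ T' → K₁ ⊆ K → K ⊆ K₁ ∪ K₂ → Spans F v K₂ →
                     L v (T ─ K₁) ≤ L v (T ─ K) + cost F
  lowerBound-merge {v} {K} {K₁} {K₂} K⊆T' K₁⊆K K⊆K₁∪K₂ spans =
    lowerBound (r∈T─K K⊆T') (T─-antitone K₁⊆K) (p─q⊆p T _) (spans-⊆ ⊆K₂ spans) here
    where
    ⊆K₂ : (T ─ K₁) ─ (T ─ K) ⊆ K₂
    ⊆K₂ {x} x∈ with x∈p─q⁻ (T ─ K₁) _ x∈
    ... | x∈T─K₁ , x∉T─K with x∈p─q⁻ T K₁ x∈T─K₁ | x ∈? K
    ...   | x∈T , _    | no  x∉K = ⊥-elim (x∉T─K (x∈p∧x∉q⇒x∈p─q x∈T x∉K))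
    ...   | _ , x∉K₁ | yes x∈K = [ ⊥-elim ∘ x∉K₁ , (λ x∈K₂ → x∈K₂) ]′ (x∈p∪q⁻ K₁ K₂ (K⊆K₁∪K₂ x∈K))

  Backtracks : State → Fin nV → Subset nV → Set
  Backtracks s w K = ∃ λ y → l s w K ≡ fin y × ∃ λ F → Backtrack s w K F × Spans F w K × cost F ≤ y

  record Invariant (s : State) : Set where
    field
      ∅-processed   : ∀ w → P s w ∅ ≡ true
      ∅-zero        : ∀ w → l s w ∅ ≡ fin 0#
      N⇒¬P          : ∀ {w K} → N s w K ≡ true → P s w K ≡ false
      N⊆T'          : ∀ {w K} → N s w K ≡ true → K ⊆ T'
      P⊆T'          : ∀ {w K} → P s w K ≡ true → K ⊆ T'
      N⇒finite      : ∀ {w K} → N s w K ≡ true → IsFinite (l s w K)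
      finite⇒N      : ∀ {w K} → P s w K ≡ false → IsFinite (l s w K) → N s w K ≡ true
      nonneg        : ∀ {w K x} → l s w K ≡ fin x → 0# ≤ x
      leaf-zero     : ∀ {w} → w ∈ T' → l s w ⁅ w ⁆ ≤ᶠ 0#
      P-optimal     : ∀ {w K} → P s w K ≡ true → (d : Derivation T' w K) → l s w K ≤ᶠ weight d
      edge-relaxed  : ∀ {e u w K y} → P s u K ≡ true → P s w K ≡ false → Joins e u w →
                      l s u K ≡ fin y → l s w K ≤ᶠ y + c e
      merge-relaxed : ∀ {v K₁ K₂ y₁ y₂} → P s v K₁ ≡ true → P s v K₂ ≡ true → P s v (K₁ ∪ K₂) ≡ false →
                      Nonempty K₁ → Nonempty K₂ → K₂ ⊆ T' ─ K₁ →
                      l s v K₁ ≡ fin y₁ → l s v K₂ ≡ fin y₂ → l s v (K₁ ∪ K₂) ≤ᶠ y₁ + y₂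
      via-none      : ∀ {w K} → b s w K ≡ none → IsFinite (l s w K) → K ⊆ ⁅ w ⁆
      via-edge      : ∀ {w K e u} → b s w K ≡ viaEdge e u →
                      P s u K ≡ true × Joins e u w × l s w K ≡ l s u K ⊕ fin (c e)
      via-merge     : ∀ {w K K₁ K₂} → b s w K ≡ merge K₁ K₂ →
                      P s w K₁ ≡ true × P s w K₂ ≡ true × K ≡ K₁ ∪ K₂ × l s w K ≡ l s w K₁ ⊕ l s w K₂
      P⇒backtracks  : ∀ {w K} → P s w K ≡ true → Backtracks s w K

  Frontier : State → Carrier → Set
  Frontier s z = ∃₂ λ w K → N s w K ≡ true × ∃ λ y → l s w K ≡ fin y × y + L w (T ─ K) ≤ z

  +-shift : ∀ {b x y z} → x ≤ y + z → b + x ≤ (b + z) + y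
  +-shift {b} {x} {y} {z} x≤y+z = begin
    b + x         ≤⟨ +-monoˡ-≤ b x≤y+z ⟩
    b + (y + z)   ≡⟨ cong (b +_) (+-comm y z) ⟩
    b + (z + y)   ≡⟨ +-assoc b z y ⟨
    (b + z) + y   ∎
    where open ≤-Reasoning

  -- Along a derivation, l + L(·, T ∖ K) can only decrease towards the labels it uses, because L
  -- is a valid lower bound; hence the derivation of an unprocessed label passes through N.
  module _ {s} (inv : Invariant s) where
    open Invariant inv

    frontier-weaken : ∀ {z z'} → Frontier s z → z ≤ z' → Frontier s z'
    frontier-weaken (w , K , Nw , y , l≡y , y+L≤z) z≤z' = w , K , Nw , y , l≡y , ≤-trans y+L≤z z≤z'

    reached : ∀ {w K z} → P s w K ≡ false → l s w K ≤ᶠ z → Frontier s (z + L w (T ─ K))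
    reached {w} {K} ¬P (y , l≡y , y≤z) = w , K , finite⇒N ¬P (y , l≡y) , y , l≡y , +-monoʳ-≤ _ y≤z

    frontier : ∀ {w K} (d : Derivation T' w K) → P s w K ≡ false → Frontier s (weight d + L w (T ─ K))
    frontier (leaf w∈T') ¬P = reached ¬P (leaf-zero w∈T')
    frontier (edge {u} {w} {K} e j d) ¬P with P s u K in Pu
    ... | true with P-optimal Pu d
    ...   | yu , lu≡yu , yu≤d = reached ¬P (≤ᶠ-≤-trans (edge-relaxed Pu ¬P j lu≡yu) (+-monoʳ-≤ (c e) yu≤d))
    frontier (edge e j d) ¬P | false =
      frontier-weaken (frontier d Pu) (+-shift (lowerBound-edge (derivation-⊆ d) j))
    frontier (merge {v} {K₁} {K₂} K₁≢∅ K₂≢∅ K₂⊆ d₁ d₂) ¬P with P s v K₁ in P₁ | P s v K₂ in P₂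
    ... | true | true with P-optimal P₁ d₁ | P-optimal P₂ d₂
    ...   | y₁ , l₁≡y₁ , y₁≤d₁ | y₂ , l₂≡y₂ , y₂≤d₂ =
      reached ¬P (≤ᶠ-≤-trans (merge-relaxed P₁ P₂ ¬P K₁≢∅ K₂≢∅ K₂⊆ l₁≡y₁ l₂≡y₂) (+-mono-≤ y₁≤d₁ y₂≤d₂))
    frontier d@(merge {v} {K₁} {K₂} _ _ _ d₁ d₂) ¬P | false | _ =
      let F₂ , spans₂ , F₂≤d₂ = derivation⇒spans d₂
      in frontier-weaken (frontier d₁ P₁)
           (+-shift (≤-trans (lowerBound-merge (derivation-⊆ d) (p⊆p∪q K₂) (λ x∈ → x∈) spans₂)
                             (+-monoˡ-≤ _ F₂≤d₂)))
    frontier d@(merge {v} {K₁} {K₂} _ _ _ d₁ d₂) ¬P | true | false =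
      let F₁ , spans₁ , F₁≤d₁ = derivation⇒spans d₁
      in frontier-weaken (frontier d₂ P₂)
           (≤-trans (+-shift (≤-trans (lowerBound-merge (derivation-⊆ d) (q⊆p∪q K₁ K₂) K⊆K₂∪K₁ spans₁)
                                      (+-monoˡ-≤ _ F₁≤d₁)))
                    (inj₂ (cong (_+ L v (T ─ (K₁ ∪ K₂))) (+-comm (weight d₂) (weight d₁)))))
      where
      K⊆K₂∪K₁ : K₁ ∪ K₂ ⊆ K₂ ∪ K₁
      K⊆K₂∪K₁ = subst (_ ∈_) (∪-comm K₁ K₂)

  sameLabel? : ∀ (w : Fin nV) (K : Subset nV) v I → Dec (w ≡ v × K ≡ I)
  sameLabel? w K v I = (w Fin.≟ v) ×-dec (≡-dec Bool._≟_ K I)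

  module Preservation {s s'} (inv : Invariant s) (st : Step s s') where
    open Invariant inv
    open Step st

    data Effect (w : Fin nV) (K : Subset nV) : Set where
      relaxed   : ∀ e → EdgeCond s v I w K e → l s' w K ≡ l s v I ⊕ fin (c e) → b s' w K ≡ viaEdge e v →
                  added w K ≡ true → Effect w K
      merged    : ∀ J → MergeCond s v I w K J → l s' w K ≡ l s v I ⊕ l s v J → b s' w K ≡ merge I J →
                  added w K ≡ true → Effect w K
      unchanged : (∀ e → ¬ EdgeCond s v I w K e) → (∀ J → ¬ MergeCond s v I w K J) →
                  l s' w K ≡ l s w K → b s' w K ≡ b s w K → added w K ≡ false → Effect w K

    effect : ∀ w K → Effect w K
    effect w K = fromUpdate (update w K) refl refl refl
      where
      fromUpdate : ∀ {x β a} → Update s v I w K x β a → x ≡ l s' w K → β ≡ b s' w K → a ≡ added w K → Effect w K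
      fromUpdate (edgeUpd e cond)   l≡ b≡ a≡ = relaxed e cond (sym l≡) (sym b≡) (sym a≡)
      fromUpdate (mergeUpd J cond)  l≡ b≡ a≡ = merged J cond (sym l≡) (sym b≡) (sym a≡)
      fromUpdate (noUpd ¬edge ¬mrg) l≡ b≡ a≡ = unchanged ¬edge ¬mrg (sym l≡) (sym b≡) (sym a≡)

    ¬P-chosen : P s v I ≡ false
    ¬P-chosen = N⇒¬P chosenN

    I⊆T' : I ⊆ T'
    I⊆T' = N⊆T' chosenN

    I∪J≢I : ∀ {J} → Nonempty J → J ⊆ T' ─ I → I ∪ J ≢ I
    I∪J≢I (x , x∈J) J⊆ I∪J≡I = proj₂ (x∈p─q⁻ T' I (J⊆ x∈J)) (subst (x ∈_) I∪J≡I (q⊆p∪q I _ x∈J))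

    P'-persists : ∀ {w K} → P s w K ≡ true → P s' w K ≡ true
    P'-persists {w} {K} Pw = trans (newP w K) (cong (_∨ _) Pw)

    P'-chosen : P s' v I ≡ true
    P'-chosen = trans (newP v I) (trans (cong (P s v I ∨_) (dec-true (sameLabel? v I v I) (refl , refl)))
                                        (Boolₚ.∨-zeroʳ (P s v I)))

    P'⁻ : ∀ {w K} → P s' w K ≡ true → P s w K ≡ true ⊎ (w ≡ v × K ≡ I)
    P'⁻ {w} {K} P'w with P s w K | newP w K
    ... | true  | _     = inj₁ refl
    ... | false | P'≡ = inj₂ (does-true⇒ (sameLabel? w K v I) (trans (sym P'≡) P'w))

    ¬P'⁻ : ∀ {w K} → P s' w K ≡ false → P s w K ≡ false × ¬ (w ≡ v × K ≡ I)
    ¬P'⁻ {w} {K} ¬P'w with P s w K | newP w K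
    ... | true  | P'≡ = ⊥-elim (≡true⇒≢false P'≡ ¬P'w)
    ... | false | P'≡ = refl , does-false⇒ (sameLabel? w K v I) (trans (sym P'≡) ¬P'w)

    ¬P'⁺ : ∀ {w K} → P s w K ≡ false → ¬ (w ≡ v × K ≡ I) → P s' w K ≡ false
    ¬P'⁺ {w} {K} ¬Pw ≢chosen = trans (newP w K) (cong₂ _∨_ ¬Pw (dec-false (sameLabel? w K v I) ≢chosen))

    N'⁻ : ∀ {w K} → N s' w K ≡ true → (N s w K ≡ true × ¬ (w ≡ v × K ≡ I)) ⊎ added w K ≡ true
    N'⁻ {w} {K} N'w with ∧-not-∨⁻ (trans (sym (newN w K)) N'w)
    ... | inj₁ (Nw , different) = inj₁ (Nw , does-false⇒ (sameLabel? w K v I) different)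
    ... | inj₂ isAdded          = inj₂ isAdded

    N'⁺ : ∀ {w K} → N s w K ≡ true → ¬ (w ≡ v × K ≡ I) → N s' w K ≡ true
    N'⁺ {w} {K} Nw ≢chosen =
      trans (newN w K) (cong (_∨ added w K) (cong₂ _∧_ Nw (cong not (dec-false (sameLabel? w K v I) ≢chosen))))

    added⇒N' : ∀ {w K} → added w K ≡ true → N s' w K ≡ true
    added⇒N' {w} {K} a = trans (newN w K) (trans (cong (_ ∨_) a) (Boolₚ.∨-zeroʳ _))

    processed-frozen : ∀ {w K} → P s w K ≡ true → l s' w K ≡ l s w K × b s' w K ≡ b s w K
    processed-frozen {w} {K} Pw with effect w K
    ... | relaxed _ (_ , refl , ¬Pw , _) _ _ _         = ⊥-elim (≡true⇒≢false Pw ¬Pw)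
    ... | merged _ (refl , refl , _ , _ , _ , ¬Pw , _) _ _ _ = ⊥-elim (≡true⇒≢false Pw ¬Pw)
    ... | unchanged _ _ l≡ b≡ _                        = l≡ , b≡

    chosen-frozen : l s' v I ≡ l s v I × b s' v I ≡ b s v I
    chosen-frozen with effect v I
    ... | relaxed _ (j , _) _ _ _                 = ⊥-elim (joins-irrefl j refl)
    ... | merged _ (_ , I≡I∪J , J≢∅ , J⊆ , _) _ _ _ = ⊥-elim (I∪J≢I J≢∅ J⊆ (sym I≡I∪J))
    ... | unchanged _ _ l≡ b≡ _                 = l≡ , b≡

    l-decreases : ∀ {w K z} → l s w K ≤ᶠ z → l s' w K ≤ᶠ z
    l-decreases {w} {K} l≤z with effect w K
    ... | relaxed _ (_ , refl , _ , l'<l) l'≡ _ _           rewrite l'≡ = <ᵉ-≤ᶠ-trans l'<l l≤z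
    ... | merged _ (refl , refl , _ , _ , _ , _ , l'<l) l'≡ _ _ rewrite l'≡ = <ᵉ-≤ᶠ-trans l'<l l≤z
    ... | unchanged _ _ l'≡ _ _                             rewrite l'≡ = l≤z

    finite-persists : ∀ {w K} → IsFinite (l s w K) → IsFinite (l s' w K)
    finite-persists (y , l≡y) = ≤ᶠ⇒finite (l-decreases (y , l≡y , ≤-refl))

    added⇒finite : ∀ {w K} → added w K ≡ true → IsFinite (l s' w K)
    added⇒finite {w} {K} isAdded with effect w K
    ... | relaxed _ (_ , refl , _ , l'<l) l'≡ _ _           rewrite l'≡ = <ᵉ⇒finite l'<l
    ... | merged _ (refl , refl , _ , _ , _ , _ , l'<l) l'≡ _ _ rewrite l'≡ = <ᵉ⇒finite l'<l
    ... | unchanged _ _ _ _ notAdded                        = ⊥-elim (≡true⇒≢false isAdded notAdded)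

    ∅-processed' : ∀ w → P s' w ∅ ≡ true
    ∅-processed' w = P'-persists (∅-processed w)

    ∅-zero' : ∀ w → l s' w ∅ ≡ fin 0#
    ∅-zero' w = trans (proj₁ (processed-frozen (∅-processed w))) (∅-zero w)

    N⇒¬P' : ∀ {w K} → N s' w K ≡ true → P s' w K ≡ false
    N⇒¬P' {w} {K} N'w with N'⁻ N'w
    ... | inj₁ (Nw , ≢chosen) = ¬P'⁺ (N⇒¬P Nw) ≢chosen
    ... | inj₂ isAdded with effect w K
    ...   | relaxed _ (j , refl , ¬Pw , _) _ _ _              = ¬P'⁺ ¬Pw (λ (w≡v , _) → joins-irrefl j (sym w≡v))
    ...   | merged _ (refl , refl , J≢∅ , J⊆ , _ , ¬Pw , _) _ _ _ = ¬P'⁺ ¬Pw (I∪J≢I J≢∅ J⊆ ∘ proj₂)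
    ...   | unchanged _ _ _ _ notAdded                         = ⊥-elim (≡true⇒≢false isAdded notAdded)

    N'⊆T' : ∀ {w K} → N s' w K ≡ true → K ⊆ T'
    N'⊆T' {w} {K} N'w with N'⁻ N'w
    ... | inj₁ (Nw , _) = N⊆T' Nw
    ... | inj₂ isAdded with effect w K
    ...   | relaxed _ (_ , refl , _) _ _ _                  = I⊆T'
    ...   | merged _ (refl , refl , _ , J⊆ , _) _ _ _       =
      [ I⊆T' , proj₁ ∘ x∈p─q⁻ T' I ∘ J⊆ ]′ ∘ x∈p∪q⁻ I _
    ...   | unchanged _ _ _ _ notAdded                     = ⊥-elim (≡true⇒≢false isAdded notAdded)

    P'⊆T' : ∀ {w K} → P s' w K ≡ true → K ⊆ T'
    P'⊆T' P'w with P'⁻ P'w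
    ... | inj₁ Pw            = P⊆T' Pw
    ... | inj₂ (refl , refl) = I⊆T'

    N⇒finite' : ∀ {w K} → N s' w K ≡ true → IsFinite (l s' w K)
    N⇒finite' N'w with N'⁻ N'w
    ... | inj₁ (Nw , _) = finite-persists (N⇒finite Nw)
    ... | inj₂ isAdded  = added⇒finite isAdded

    finite⇒N' : ∀ {w K} → P s' w K ≡ false → IsFinite (l s' w K) → N s' w K ≡ true
    finite⇒N' {w} {K} ¬P'w finite with ¬P'⁻ ¬P'w
    ... | ¬Pw , ≢chosen with effect w K
    ...   | relaxed _ _ _ _ isAdded    = added⇒N' isAdded
    ...   | merged _ _ _ _ isAdded     = added⇒N' isAdded
    ...   | unchanged _ _ l≡ _ _       = N'⁺ (finite⇒N ¬Pw (subst IsFinite l≡ finite)) ≢chosen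

    nonneg' : ∀ {w K x} → l s' w K ≡ fin x → 0# ≤ x
    nonneg' {w} {K} l'≡x with effect w K
    ... | relaxed e _ l'≡ _ _ with ⊕≡fin⁻ (trans (sym l'≡) l'≡x)
    ...   | _ , _ , l≡ , refl , refl = 0≤x+y (nonneg l≡) (inj₁ (c>0 e))
    nonneg' {w} {K} l'≡x | merged J _ l'≡ _ _ with ⊕≡fin⁻ (trans (sym l'≡) l'≡x)
    ...   | _ , _ , l≡ , lJ≡ , refl = 0≤x+y (nonneg l≡) (nonneg lJ≡)
    nonneg' {w} {K} l'≡x | unchanged _ _ l'≡ _ _ = nonneg (trans (sym l'≡) l'≡x)

    leaf-zero' : ∀ {w} → w ∈ T' → l s' w ⁅ w ⁆ ≤ᶠ 0#
    leaf-zero' = l-decreases ∘ leaf-zero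

    chosen-key-least : ∀ {a z} → l s v I ≡ fin a → Frontier s z → a + L v (T ─ I) ≤ z
    chosen-key-least {a} l≡a (w , K , Nw , y , l≡y , y+L≤z) =
      ≤-trans (≮⇒≥ (subst₂ (λ p q → (p ⊕ fin (L v (T ─ I))) ≤ᵉ (q ⊕ fin (L w (T ─ K))))
                           l≡a l≡y (minimal w K Nw)))
              y+L≤z

    P-optimal' : ∀ {w K} → P s' w K ≡ true → (d : Derivation T' w K) → l s' w K ≤ᶠ weight d
    P-optimal' P'w d with P'⁻ P'w
    ... | inj₁ Pw rewrite proj₁ (processed-frozen Pw) = P-optimal Pw d
    ... | inj₂ (refl , refl) with N⇒finite chosenN
    ...   | a , l≡a = a , trans (proj₁ chosen-frozen) l≡a
                    , +-cancelʳ-≤ (L v (T ─ I)) (chosen-key-least l≡a (frontier inv d ¬P-chosen))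

    chosen-l : ∀ {y} → l s' v I ≡ fin y → l s v I ≡ fin y
    chosen-l = trans (sym (proj₁ chosen-frozen))

    processed-l : ∀ {w K y} → P s w K ≡ true → l s' w K ≡ fin y → l s w K ≡ fin y
    processed-l Pw = trans (sym (proj₁ (processed-frozen Pw)))

    edge-relaxed' : ∀ {e u w K y} → P s' u K ≡ true → P s' w K ≡ false → Joins e u w →
                    l s' u K ≡ fin y → l s' w K ≤ᶠ y + c e
    edge-relaxed' {e} {u} {w} {K} {y} P'u ¬P'w j l'u≡y with ¬P'⁻ ¬P'w | P'⁻ P'u
    ... | ¬Pw , _ | inj₁ Pu = l-decreases (edge-relaxed Pu ¬Pw j (processed-l Pu l'u≡y))
    ... | ¬Pw , _ | inj₂ (refl , refl) with effect w I
    ...   | relaxed e' (j' , _) l'≡ _ _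
      rewrite joins-injective j' j | l'≡ | chosen-l l'u≡y = y + c e , refl , ≤-refl
    ...   | merged _ (w≡v , _) _ _ _    = ⊥-elim (joins-irrefl j (sym w≡v))
    ...   | unchanged ¬relax _ l'≡ _ _ rewrite l'≡ =
      ≤ᵉ⇒≤ᶠ λ y+e<l →
        ¬relax e (j , refl , ¬Pw , subst (λ x → (x ⊕ fin (c e)) <ᵉ l s w I) (sym (chosen-l l'u≡y)) y+e<l)

    merged-with-chosen : ∀ {J y₁ y₂} → P s v J ≡ true → P s v (I ∪ J) ≡ false → Nonempty J → J ⊆ T' ─ I →
                         l s v I ≡ fin y₁ → l s v J ≡ fin y₂ → l s' v (I ∪ J) ≤ᶠ y₁ + y₂
    merged-with-chosen {J} {y₁} {y₂} PJ ¬P J≢∅ J⊆ l≡y₁ lJ≡y₂ with effect v (I ∪ J)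
    ... | relaxed _ (j , _) _ _ _ = ⊥-elim (joins-irrefl j refl)
    ... | merged J' (_ , I∪J≡I∪J' , _ , J'⊆ , _) l'≡ _ _
      with ∪-cancelˡ I∪J≡I∪J' (proj₂ ∘ x∈p─q⁻ T' I ∘ J⊆) (proj₂ ∘ x∈p─q⁻ T' I ∘ J'⊆)
    ...   | refl rewrite l'≡ | l≡y₁ | lJ≡y₂ = y₁ + y₂ , refl , ≤-refl
    merged-with-chosen {J} {y₁} {y₂} PJ ¬P J≢∅ J⊆ l≡y₁ lJ≡y₂ | unchanged _ ¬merge l'≡ _ _ rewrite l'≡ =
      ≤ᵉ⇒≤ᶠ λ y₁+y₂<l →
        ¬merge J ( refl , refl , J≢∅ , J⊆ , PJ , ¬P
                 , subst₂ (λ p q → (p ⊕ q) <ᵉ l s v (I ∪ J)) (sym l≡y₁) (sym lJ≡y₂) y₁+y₂<l )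

    merge-relaxed' : ∀ {w K₁ K₂ y₁ y₂} → P s' w K₁ ≡ true → P s' w K₂ ≡ true → P s' w (K₁ ∪ K₂) ≡ false →
                     Nonempty K₁ → Nonempty K₂ → K₂ ⊆ T' ─ K₁ →
                     l s' w K₁ ≡ fin y₁ → l s' w K₂ ≡ fin y₂ → l s' w (K₁ ∪ K₂) ≤ᶠ y₁ + y₂
    merge-relaxed' {w} {K₁} {K₂} {y₁} {y₂} P'₁ P'₂ ¬P' K₁≢∅ K₂≢∅ K₂⊆ l'₁ l'₂
      with ¬P'⁻ ¬P' | P'⁻ P'₁ | P'⁻ P'₂
    ... | ¬P , _ | inj₁ P₁ | inj₁ P₂ =
      l-decreases (merge-relaxed P₁ P₂ ¬P K₁≢∅ K₂≢∅ K₂⊆ (processed-l P₁ l'₁) (processed-l P₂ l'₂))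
    ... | _ | inj₂ (refl , refl) | inj₂ (_ , refl) =
      let x , x∈I = K₂≢∅ in ⊥-elim (proj₂ (x∈p─q⁻ T' I (K₂⊆ x∈I)) x∈I)
    ... | ¬P , _ | inj₂ (refl , refl) | inj₁ P₂ =
      merged-with-chosen P₂ ¬P K₂≢∅ K₂⊆ (chosen-l l'₁) (processed-l P₂ l'₂)
    ... | ¬P , _ | inj₁ P₁ | inj₂ (refl , refl) =
      subst₂ _≤ᶠ_ (cong (l s' v) (∪-comm I K₁)) (+-comm y₂ y₁)
        (merged-with-chosen P₁ (subst (λ K → P s v K ≡ false) (∪-comm K₁ I) ¬P) K₁≢∅ K₁⊆T'─I
                            (chosen-l l'₂) (processed-l P₁ l'₁))
      where
      K₁⊆T'─I : K₁ ⊆ T' ─ I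
      K₁⊆T'─I x∈K₁ = x∈p∧x∉q⇒x∈p─q (P⊆T' P₁ x∈K₁) λ x∈I → proj₂ (x∈p─q⁻ T' K₁ (K₂⊆ x∈I)) x∈K₁

    via-none' : ∀ {w K} → b s' w K ≡ none → IsFinite (l s' w K) → K ⊆ ⁅ w ⁆
    via-none' {w} {K} b'≡ finite with effect w K
    ... | relaxed _ _ _ b'≡edge _          with trans (sym b'≡edge) b'≡
    ...   | ()
    via-none' {w} {K} b'≡ finite | merged _ _ _ b'≡merge _ with trans (sym b'≡merge) b'≡
    ...   | ()
    via-none' {w} {K} b'≡ finite | unchanged _ _ l≡ b≡ _ =
      via-none (trans (sym b≡) b'≡) (subst IsFinite l≡ finite)

    via-edge' : ∀ {w K e u} → b s' w K ≡ viaEdge e u →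
                P s' u K ≡ true × Joins e u w × l s' w K ≡ l s' u K ⊕ fin (c e)
    via-edge' {w} {K} b'≡ with effect w K
    ... | relaxed _ (j , refl , _) l'≡ b'≡edge _ with trans (sym b'≡edge) b'≡
    ...   | refl = P'-chosen , j , trans l'≡ (cong (_⊕ fin (c _)) (sym (proj₁ chosen-frozen)))
    via-edge' {w} {K} b'≡ | merged _ _ _ b'≡merge _ with trans (sym b'≡merge) b'≡
    ...   | ()
    via-edge' {w} {K} b'≡ | unchanged _ _ l'≡ b≡ _ with via-edge (trans (sym b≡) b'≡)
    ...   | Pu , j , l≡ =
      P'-persists Pu , j , trans l'≡ (trans l≡ (cong (_⊕ fin (c _)) (sym (proj₁ (processed-frozen Pu)))))

    via-merge' : ∀ {w K K₁ K₂} → b s' w K ≡ merge K₁ K₂ →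
                 P s' w K₁ ≡ true × P s' w K₂ ≡ true × K ≡ K₁ ∪ K₂ × l s' w K ≡ l s' w K₁ ⊕ l s' w K₂
    via-merge' {w} {K} b'≡ with effect w K
    ... | relaxed _ _ _ b'≡edge _ with trans (sym b'≡edge) b'≡
    ...   | ()
    via-merge' {w} {K} b'≡ | merged J (refl , refl , _ , _ , PJ , _) l'≡ b'≡merge _ with trans (sym b'≡merge) b'≡
    ...   | refl = P'-chosen , P'-persists PJ , refl
                 , trans l'≡ (cong₂ _⊕_ (sym (proj₁ chosen-frozen)) (sym (proj₁ (processed-frozen PJ))))
    via-merge' {w} {K} b'≡ | unchanged _ _ l'≡ b≡ _ with via-merge (trans (sym b≡) b'≡)
    ...   | P₁ , P₂ , K≡ , l≡ =
      P'-persists P₁ , P'-persists P₂ , K≡ ,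
      trans l'≡ (trans l≡ (cong₂ _⊕_ (sym (proj₁ (processed-frozen P₁))) (sym (proj₁ (processed-frozen P₂)))))

    -- Backtracking from a processed label only reads processed labels, whose data never change.
    backtrack-persists : ∀ {w K F} → b s' w K ≡ b s w K → Backtrack s w K F → Backtrack s' w K F
    backtrack-persists b≡ (btNone b≡none) = btNone (trans b≡ b≡none)
    backtrack-persists b≡ (btEdge b≡edge bt) =
      btEdge (trans b≡ b≡edge) (backtrack-persists (proj₂ (processed-frozen (proj₁ (via-edge b≡edge)))) bt)
    backtrack-persists b≡ (btMerge b≡merge bt₁ bt₂) with via-merge b≡merge
    ... | P₁ , P₂ , _ = btMerge (trans b≡ b≡merge) (backtrack-persists (proj₂ (processed-frozen P₁)) bt₁)
                                                  (backtrack-persists (proj₂ (processed-frozen P₂)) bt₂)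

    finite⇒backtracks : ∀ {w K} → IsFinite (l s w K) → Backtracks s w K
    finite⇒backtracks {w} {K} (y , l≡y) with b s w K in b≡
    ... | none =
      y , l≡y , ∅ , btNone b≡ , spans-∅ (via-none b≡ (y , l≡y)) , subst (_≤ y) (sym (sumOver-∅ c)) (nonneg l≡y)
    ... | viaEdge e u with via-edge b≡
    ...   | Pu , j , l≡ with P⇒backtracks Pu
    ...     | yu , lu≡ , F , bt , spans , F≤ =
      y , l≡y , ⁅ e ⁆ ∪ F , btEdge b≡ bt , spans-edge j spans ,
      subst (cost (⁅ e ⁆ ∪ F) ≤_) (fin-injective (trans (sym (trans l≡ (cong (_⊕ fin (c e)) lu≡))) l≡y))
            (cost-edge F≤)
    finite⇒backtracks {w} {K} (y , l≡y) | merge K₁ K₂ with via-merge b≡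
    ... | P₁ , P₂ , refl , l≡ with P⇒backtracks P₁ | P⇒backtracks P₂
    ...   | y₁ , l₁≡ , F₁ , bt₁ , spans₁ , F₁≤ | y₂ , l₂≡ , F₂ , bt₂ , spans₂ , F₂≤ =
      y , l≡y , F₁ ∪ F₂ , btMerge b≡ bt₁ bt₂ , spans-∪ spans₁ spans₂ ,
      subst (cost (F₁ ∪ F₂) ≤_) (fin-injective (trans (sym (trans l≡ (cong₂ _⊕_ l₁≡ l₂≡))) l≡y))
            (≤-trans (cost-∪ F₁ F₂) (+-mono-≤ F₁≤ F₂≤))

    P⇒backtracks' : ∀ {w K} → P s' w K ≡ true → Backtracks s' w K
    P⇒backtracks' P'w with P'⁻ P'w
    ... | inj₁ Pw with P⇒backtracks Pw
    ...   | y , l≡y , F , bt , rest =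
      y , trans (proj₁ (processed-frozen Pw)) l≡y , F , backtrack-persists (proj₂ (processed-frozen Pw)) bt , rest
    P⇒backtracks' P'w | inj₂ (refl , refl) with finite⇒backtracks (N⇒finite chosenN)
    ...   | y , l≡y , F , bt , rest =
      y , trans (proj₁ chosen-frozen) l≡y , F , backtrack-persists (proj₂ chosen-frozen) bt , rest

    invariant : Invariant s'
    invariant = record
      { ∅-processed = ∅-processed' ; ∅-zero = ∅-zero' ; N⇒¬P = N⇒¬P' ; N⊆T' = N'⊆T' ; P⊆T' = P'⊆T'
      ; N⇒finite = N⇒finite' ; finite⇒N = finite⇒N' ; nonneg = nonneg' ; leaf-zero = leaf-zero'
      ; P-optimal = P-optimal' ; edge-relaxed = edge-relaxed' ; merge-relaxed = merge-relaxed'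
      ; via-none = via-none' ; via-edge = via-edge' ; via-merge = via-merge' ; P⇒backtracks = P⇒backtracks' }


  module Initial where
    private
      s₀ = initial

    started : Fin nV → Subset nV → Bool
    started w K = (K ==ˢ ∅) ∨ (inT' w ∧ (K ==ˢ ⁅ w ⁆))

    started⇒zero : ∀ {w K} → started w K ≡ true → l s₀ w K ≡ fin 0#
    started⇒zero = cong (if_then fin 0# else ∞)

    finite⇒started : ∀ w K → IsFinite (l s₀ w K) → started w K ≡ true
    finite⇒started w K (_ , l≡) with started w K
    ... | true  = refl
    ... | false with l≡
    ...   | ()

    ==ˢ⁻ : ∀ K {K'} → (K ==ˢ K') ≡ true → K ≡ K'
    ==ˢ⁻ K {K'} = does-true⇒ (≡-dec Bool._≟_ K K')

    ==ˢ-refl : ∀ K → (K ==ˢ K) ≡ true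
    ==ˢ-refl K = dec-true (≡-dec Bool._≟_ K K) refl

    N⁻ : ∀ w K → N s₀ w K ≡ true → w ∈ T' × K ≡ ⁅ w ⁆
    N⁻ w K N≡ with ∧≡true⁻ {inT' w} N≡
    ... | w∈T' , K≡w = does-true⇒ (w ∈? T') w∈T' , ==ˢ⁻ K K≡w

    ∅-processed₀ : ∀ w → P s₀ w ∅ ≡ true
    ∅-processed₀ w = ==ˢ-refl ∅

    ∅-zero₀ : ∀ w → l s₀ w ∅ ≡ fin 0#
    ∅-zero₀ w = started⇒zero {w} {∅} (cong (_∨ (inT' w ∧ (∅ ==ˢ ⁅ w ⁆))) (==ˢ-refl ∅))

    N⇒¬P₀ : ∀ {w K} → N s₀ w K ≡ true → P s₀ w K ≡ false
    N⇒¬P₀ {w} {K} N≡ = dec-false (≡-dec Bool._≟_ K ∅) λ K≡∅ → ∉⊥ (subst (w ∈_) (trans (sym K≡w) K≡∅) (x∈⁅x⁆ w))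
      where K≡w = proj₂ (N⁻ w K N≡)

    N⊆T'₀ : ∀ {w K} → N s₀ w K ≡ true → K ⊆ T'
    N⊆T'₀ {w} {K} N≡ x∈ with N⁻ w K N≡
    ... | w∈T' , refl = subst (_∈ T') (sym (x∈⁅y⁆⇒x≡y w x∈)) w∈T'

    P⊆T'₀ : ∀ {w K} → P s₀ w K ≡ true → K ⊆ T'
    P⊆T'₀ {w} {K} P≡ x∈ = ⊥-elim (∉⊥ (subst (_ ∈_) (==ˢ⁻ K P≡) x∈))

    N⇒finite₀ : ∀ {w K} → N s₀ w K ≡ true → IsFinite (l s₀ w K)
    N⇒finite₀ {w} {K} N≡ = 0# , started⇒zero {w} {K} (trans (cong ((K ==ˢ ∅) ∨_) N≡) (Boolₚ.∨-zeroʳ _))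

    finite⇒N₀ : ∀ {w K} → P s₀ w K ≡ false → IsFinite (l s₀ w K) → N s₀ w K ≡ true
    finite⇒N₀ {w} {K} ¬P finite = trans (sym (cong (_∨ N s₀ w K) ¬P)) (finite⇒started w K finite)

    nonneg₀ : ∀ {w K x} → l s₀ w K ≡ fin x → 0# ≤ x
    nonneg₀ {w} {K} l≡x with trans (sym (started⇒zero {w} {K} (finite⇒started w K (_ , l≡x)))) l≡x
    ... | refl = ≤-refl

    leaf-zero₀ : ∀ {w} → w ∈ T' → l s₀ w ⁅ w ⁆ ≤ᶠ 0#
    leaf-zero₀ {w} w∈T' =
      0# , started⇒zero {w} {⁅ w ⁆} (trans (cong ((⁅ w ⁆ ==ˢ ∅) ∨_) w-started) (Boolₚ.∨-zeroʳ _)) , ≤-refl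
      where
      w-started : inT' w ∧ (⁅ w ⁆ ==ˢ ⁅ w ⁆) ≡ true
      w-started = cong₂ _∧_ (dec-true (w ∈? T') w∈T') (==ˢ-refl ⁅ w ⁆)

    via-none₀ : ∀ {w K} → b s₀ w K ≡ none → IsFinite (l s₀ w K) → K ⊆ ⁅ w ⁆
    via-none₀ {w} {K} _ finite with ∨≡true⁻ (finite⇒started w K finite)
    ... | inj₁ K≡∅ = ⊥-elim ∘ ∉⊥ ∘ subst (_ ∈_) (==ˢ⁻ K K≡∅)
    ... | inj₂ N≡  = subst (_ ∈_) (proj₂ (N⁻ w K N≡))

    invariant : Invariant s₀
    invariant = record
      { ∅-processed = ∅-processed₀ ; ∅-zero = ∅-zero₀
      ; N⇒¬P = λ {w} {K} → N⇒¬P₀ {w} {K} ; N⊆T' = λ {w} {K} → N⊆T'₀ {w} {K}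
      ; P⊆T' = λ {w} {K} → P⊆T'₀ {w} {K}
      ; N⇒finite = λ {w} {K} → N⇒finite₀ {w} {K} ; finite⇒N = λ {w} {K} → finite⇒N₀ {w} {K}
      ; nonneg = λ {w} {K} → nonneg₀ {w} {K} ; leaf-zero = leaf-zero₀
      ; P-optimal = λ {_} {K} P≡ d → ⊥-elim (nonempty≢∅ (derivation-nonempty d) (==ˢ⁻ K P≡))
      ; edge-relaxed = λ {_} {_} {w} {K} P≡ ¬P _ _ →
          ⊥-elim (≡true⇒≢false (∅-processed₀ w) (subst (λ K → P s₀ w K ≡ false) (==ˢ⁻ K P≡) ¬P))
      ; merge-relaxed = λ {_} {K₁} P₁ _ _ K₁≢∅ _ _ _ _ → ⊥-elim (nonempty≢∅ K₁≢∅ (==ˢ⁻ K₁ P₁))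
      ; via-none = via-none₀ ; via-edge = λ () ; via-merge = λ ()
      ; P⇒backtracks = λ {_} {K} P≡ → backtracks∅ (==ˢ⁻ K P≡) }
      where
      nonempty≢∅ : ∀ {K : Subset nV} → Nonempty K → K ≢ ∅
      nonempty≢∅ (x , x∈) refl = ∉⊥ x∈
      backtracks∅ : ∀ {w K} → K ≡ ∅ → Backtracks s₀ w K
      backtracks∅ refl = 0# , ∅-zero₀ _ , ∅ , btNone refl , spans-∅ (⊥-elim ∘ ∉⊥) , inj₂ (sumOver-∅ c)

  labels : List (Fin nV × Subset nV)
  labels = cartesianProduct (allFin nV) (allSubsets nV)

  ∈-labels : ∀ w K → (w , K) ∈ₗ labels
  ∈-labels w K = Listₚ.∈-cartesianProduct⁺ (Listₚ.∈-allFin w) (∈-allSubsets K)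

  key : State → Fin nV × Subset nV → Ext
  key s (w , K) = l s w K ⊕ fin (L w (T ─ K))

  step-from : ∀ {s} v I → N s v I ≡ true → (∀ w K → N s w K ≡ true → key s (v , I) ≤ᵉ key s (w , K)) →
              ∃ λ s' → Step s s'
  step-from {s} v I Nv least = s' , record
    { v = v ; I = I ; chosenN = Nv ; minimal = least
    ; added = λ w K → proj₁ (proj₂ (proj₂ (decide w K)))
    ; update = λ w K → proj₂ (proj₂ (proj₂ (decide w K)))
    ; newN = λ w K → refl ; newP = λ w K → refl }
    where
    edge? : ∀ w K → Dec (∃ λ e → EdgeCond s v I w K e)
    edge? w K = Finₚ.any? λ e → joins? e v w ×-dec ≡-dec Bool._≟_ K I ×-dec (P s w I Bool.≟ false)
                                ×-dec ((l s v I ⊕ fin (c e)) <ᵉ? l s w I)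
    merge? : ∀ w K → Dec (∃ λ J → MergeCond s v I w K J)
    merge? w K = anySubset? λ J → (w Fin.≟ v) ×-dec ≡-dec Bool._≟_ K (I ∪ J) ×-dec nonempty? J ×-dec (J ⊆? T' ─ I)
                                  ×-dec (P s v J Bool.≟ true) ×-dec (P s v (I ∪ J) Bool.≟ false)
                                  ×-dec ((l s v I ⊕ l s v J) <ᵉ? l s v (I ∪ J))
    decide : ∀ w K → Σ Ext λ x → Σ BData λ β → Σ Bool λ a → Update s v I w K x β a
    decide w K with edge? w K | merge? w K
    ... | yes (e , cond) | _              = _ , _ , _ , edgeUpd e cond
    ... | no ¬edge       | yes (J , cond) = _ , _ , _ , mergeUpd J cond
    ... | no ¬edge       | no ¬merge      =
      _ , _ , _ , noUpd (λ e cond → ¬edge (e , cond)) (λ J cond → ¬merge (J , cond))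
    s' : State
    s' = record
      { l = λ w K → proj₁ (decide w K)
      ; b = λ w K → proj₁ (proj₂ (decide w K))
      ; N = λ w K → (N s w K ∧ not ((w ==ᵛ v) ∧ (K ==ˢ I))) ∨ proj₁ (proj₂ (proj₂ (decide w K)))
      ; P = λ w K → P s w K ∨ ((w ==ᵛ v) ∧ (K ==ˢ I)) }

  -- Before termination (r, T') is unprocessed, so by the frontier lemma N is nonempty.
  progress : ∀ {s} → Invariant s → ¬ Done s → ∃ λ s' → Step s s'
  progress {s} inv ¬done with least? (λ (w , K) → N s w K Bool.≟ true) labels
    where open Least (λ x y → key s x ≤ᵉ key s y) (λ x y → ≤ᵉ-total (key s x) (key s y))
                     (λ {x} {y} {z} → ≤ᵉ-trans {key s x} {key s y} {key s z})
  ... | inj₁ ((v , I) , Nv , least) = step-from v I Nv λ w K Nw → least (w , K) (∈-labels w K) Nw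
  ... | inj₂ N≡∅ with P s r T' in Pr
  ...   | true  = ⊥-elim (¬done refl)
  ...   | false with nonempty? T'
  ...     | no T'≡∅ =
    ⊥-elim (≡true⇒≢false (Invariant.∅-processed inv r) (subst (λ K → P s r K ≡ false) (Empty-unique T'≡∅) Pr))
  ...     | yes T'≢∅ with frontier inv (proj₁ (spans⇒derivation (connected⇒spans connected) (λ x∈ → x∈) T'≢∅)) Pr
  ...       | w , K , Nw , _ = ⊥-elim (N≡∅ (w , K) (∈-labels w K) Nw)

  unprocessed : State → List (Fin nV × Subset nV) → ℕ
  unprocessed s []             = 0
  unprocessed s ((w , K) ∷ xs) = (if P s w K then 0 else 1) ℕ.+ unprocessed s xs

  module _ {s s'} (P⊆P' : ∀ {w K} → P s w K ≡ true → P s' w K ≡ true) where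

    indicator-mono : ∀ w K → (if P s' w K then 0 else 1) ℕ.≤ (if P s w K then 0 else 1)
    indicator-mono w K with P s w K in Pw | P s' w K in P'w
    ... | true  | true  = z≤n
    ... | true  | false = ⊥-elim (≡true⇒≢false (P⊆P' Pw) P'w)
    ... | false | true  = z≤n
    ... | false | false = s≤s z≤n

    unprocessed-mono : ∀ xs → unprocessed s' xs ℕ.≤ unprocessed s xs
    unprocessed-mono []             = z≤n
    unprocessed-mono ((w , K) ∷ xs) = ℕₚ.+-mono-≤ (indicator-mono w K) (unprocessed-mono xs)

    unprocessed-strict : ∀ {v I} → P s v I ≡ false → P s' v I ≡ true →
                         ∀ xs → (v , I) ∈ₗ xs → unprocessed s' xs ℕ.< unprocessed s xs
    unprocessed-strict ¬P P' ((w , K) ∷ xs) (here refl) rewrite ¬P | P' = s≤s (unprocessed-mono xs)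
    unprocessed-strict ¬P P' ((w , K) ∷ xs) (there v,I∈) =
      ℕₚ.+-mono-≤-< (indicator-mono w K) (unprocessed-strict ¬P P' xs v,I∈)

  step-decreases : ∀ {s s'} → Invariant s → Step s s' → unprocessed s' labels ℕ.< unprocessed s labels
  step-decreases inv st =
    unprocessed-strict P'-persists ¬P-chosen P'-chosen labels (∈-labels (Step.v st) (Step.I st))
    where open Preservation inv st

  terminates : ∀ n {s} → Invariant s → unprocessed s labels ℕ.< n → Terminates s
  terminates (suc n) {s} inv (s≤s bound) with P s r T' in Pr
  ... | true  = finished Pr
  ... | false =
    let ¬done = λ done → ≡true⇒≢false done Pr in
    continue ¬done (progress inv ¬done)
      λ s' st → terminates n (Preservation.invariant inv st) (ℕₚ.<-≤-trans (step-decreases inv st) bound)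

  reachable-invariant : ∀ {s} → Reachable s → Invariant s
  reachable-invariant = go Initial.invariant
    where
    go : ∀ {s₁ s₂} → Invariant s₁ → Star LoopStep s₁ s₂ → Invariant s₂
    go inv ε               = inv
    go inv ((_ , st) ◅ run) = go (Preservation.invariant inv st) run

  done-optimal : ∀ {s} → Invariant s → Done s → ∀ F → Spans F r T' → l s r T' ≤ᶠ cost F
  done-optimal {s} inv done F spans with nonempty? T'
  ... | yes T'≢∅ = let d , d≤F = spans⇒derivation spans (λ x∈ → x∈) T'≢∅ in
                   ≤ᶠ-≤-trans (Invariant.P-optimal inv done d) d≤F
  ... | no  T'≡∅ rewrite Empty-unique T'≡∅ = 0# , Invariant.∅-zero inv r , cost-nonneg F

  spans-T : ∀ {F} → Spans F r T' → Spans F r T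
  spans-T {F} (toT' , toSrc) = toT , toSrc
    where
    toT : ∀ {x} → x ∈ T → Path F r x
    toT {x} x∈T with x Fin.≟ r
    ... | yes refl = here
    ... | no  x≢r  = toT' (x∈p∧x≢y⇒x∈p-y x∈T x≢r)

  result : ∀ s → Reachable s → Done s → ∃ λ F → Backtrack s r T' F × OptimumSteinerTreeEdges T F
  result s reachable done with P⇒backtracks done
    where open Invariant (reachable-invariant reachable)
  ... | y , l≡y , F , bt , spans , F≤y = F , bt , minimum⇒optimum ((r , r∈T , spans-T spans) , minimal)
    where
    minimal : ∀ F' → Interconnects F' T → cost F ≤ cost F'
    minimal F' interconnects with done-optimal (reachable-invariant reachable) done F'
                                    (spans-⊆ T'⊆T (interconnects⇒spans interconnects r∈T))
    ... | y' , l≡y' , y'≤F' = ≤-trans F≤y (subst (_≤ cost F') (fin-injective (trans (sym l≡y') l≡y)) y'≤F')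

  correct : Correct
  correct = terminates _ Initial.invariant (ℕₚ.n<1+n _) , result

theorem1 : (𝔽 : OrderedField) → (G : Graph) →
    (c : Fin (Graph.nE G) → OrderedField.Carrier 𝔽) →
    (∀ e → OrderedField._<_ 𝔽 (OrderedField.0# 𝔽) (c e)) →
    Steiner.GraphTheory.Connected 𝔽 G c →
    (T : Subset (Graph.nV G)) → (r : Fin (Graph.nV G)) → r ∈ T →
    (L : Fin (Graph.nV G) → Subset (Graph.nV G) → OrderedField.Carrier 𝔽) →
    Steiner.GraphTheory.ValidLowerBound 𝔽 G c T r L →
    Steiner.DijkstraSteiner.Correct 𝔽 G c T r L
theorem1 𝔽 G c c>0 connected T r r∈T L valid = Correctness.correct 𝔽 G c c>0 connected T r r∈T L valid
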